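{- As formal power series (equivalently, as analytic functions near $x=0$, using the branch of the square root equal to $1$ at $x=0$), $$\sum_{n\ge0}a_{n,n}x^n=\frac{1}{\sqrt{1-2x-x^2-2x^3+x^4}}.$$
   Context: For nonnegative integers $p,q$, $a_{p,q}$ is the number of ways to partition a set consisting of $p$ marked points on a line and $q$ marked points on a parallel line into pairs, joining the two points of each pair by a straight segment, such that no two segments have a common point (in particular, no endpoint lies on another segment). We have $a_{0,0}=1$. -}

module Defs where

open import Data.Bool using (Bool; true; false; _∧_; _∨_; not; if_then_else_)
open import Data.Nat using (ℕ; zero; suc; _∸_; _<ᵇ_; _≤ᵇ_; _≡ᵇ_; _⊔_; _⊓_)
open import Data.Fin using (Fin; toℕ)
open import Data.List using (List; []; _∷_; [_]; map; concatMap; allFin)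
open import Data.Bool.ListAction using (and)
open import Data.Nat.ListAction using (sum)
open import Data.Vec using (Vec; lookup)
import Data.Vec as V
open import Data.Product using (_×_; _,_)
open import Data.Integer using (ℤ; +_; -[1+_]) renaming (_+_ to _+ℤ_; _*_ to _*ℤ_)

-- A marked point is (line , position): line false = first line (y = 0),
-- line true = second, parallel line (y = 1); position = x-coordinate.
-- The p points of the first line are at x = 0,…,p-1, the q points of the
-- second line at x = 0,…,q-1 (only the order of points on each line matters).

Point : Set
Point = Bool × ℕ

Segment : Set
Segment = Point × Point

beq : Bool → Bool → Bool
beq true  b = b
beq false b = not b

between : ℕ → ℕ → ℕ → Bool
between u v a = ((u ⊓ v) ≤ᵇ a) ∧ (a ≤ᵇ (u ⊔ v))

-- position of the endpoint of a segment that lies on the given line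
-- (used only for segments joining the two lines)
endOn : Bool → Segment → ℕ
endOn l ((l₁ , x₁) , (l₂ , x₂)) = if beq l l₁ then x₁ else x₂

isFlat : Segment → Bool
isFlat ((l₁ , _) , (l₂ , _)) = beq l₁ l₂

lineOf : Segment → Bool
lineOf ((l₁ , _) , _) = l₁

lo hi : Segment → ℕ
lo ((_ , x₁) , (_ , x₂)) = x₁ ⊓ x₂
hi ((_ , x₁) , (_ , x₂)) = x₁ ⊔ x₂

-- Do two straight segments have a common point?
--  * two segments lying on lines: same line and overlapping closed intervals;
--  * a segment on a line and a segment joining the lines: the latter's
--    endpoint on that line lies in the former's closed interval;
--  * two segments joining the lines (from (a,0) to (b,1)): they meet iff
--    they share an endpoint or their endpoints are in opposite order.
meet : Segment → Segment → Bool
meet s t with isFlat s | isFlat t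
... | true  | true  = beq (lineOf s) (lineOf t) ∧ ((lo s ⊔ lo t) ≤ᵇ (hi s ⊓ hi t))
... | true  | false = between (lo s) (hi s) (endOn (lineOf s) t)
... | false | true  = between (lo t) (hi t) (endOn (lineOf t) s)
... | false | false =
  not (((a₁ <ᵇ a₂) ∧ (b₁ <ᵇ b₂)) ∨ ((a₂ <ᵇ a₁) ∧ (b₂ <ᵇ b₁)))
  where
  a₁ = endOn false s
  b₁ = endOn true s
  a₂ = endOn false t
  b₂ = endOn true t

-- The p + q points are indexed by Fin (p + q): index i < p is
-- the point at position i on the first line, index p + j is the point at
-- position j on the second line.  A partition into pairs is encoded by the
-- fixed-point-free involution m sending each point to its partner.

pt : (p q : ℕ) → Fin (p Data.Nat.+ q) → Point
pt p q i = if toℕ i <ᵇ p then (false , toℕ i) else (true , toℕ i ∸ p)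

finEq : ∀ {n} → Fin n → Fin n → Bool
finEq i j = toℕ i ≡ᵇ toℕ j

allᵇ : ∀ n → (Fin n → Bool) → Bool
allᵇ n P = and (map P (allFin n))

allVecs : (n m : ℕ) → List (Vec (Fin m) n)
allVecs zero    m = [ V.[] ]
allVecs (suc n) m = concatMap (λ v → map (V._∷ v) (allFin m)) (allVecs n m)

validMatching : (p q : ℕ) → Vec (Fin (p Data.Nat.+ q)) (p Data.Nat.+ q) → Bool
validMatching p q m =
  allᵇ N (λ i → not (finEq (f i) i) ∧ finEq (f (f i)) i)
  ∧ allᵇ N (λ i → allᵇ N (λ j →
      if finEq j i ∨ finEq j (f i) then true
      else not (meet (seg i) (seg j))))
  where
  N = p Data.Nat.+ q
  f = lookup m
  seg : Fin N → Segment
  seg i = (pt p q i , pt p q (f i))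

a : ℕ → ℕ → ℕ
a p q = sum (map (λ m → if validMatching p q m then 1 else 0)
                 (allVecs (p Data.Nat.+ q) (p Data.Nat.+ q)))

Series : Set
Series = ℕ → ℤ

sumTo : ℕ → (ℕ → ℤ) → ℤ
sumTo zero    f = f zero
sumTo (suc n) f = sumTo n f +ℤ f (suc n)

_⊛_ : Series → Series → Series
(f ⊛ g) n = sumTo n (λ k → f k *ℤ g (n ∸ k))

one : Series
one zero    = + 1
one (suc _) = + 0

P : Series
P 0 = + 1
P 1 = -[1+ 1 ]
P 2 = -[1+ 0 ]
P 3 = -[1+ 1 ]
P 4 = + 1
P _ = + 0

diagSeries : Series
diagSeries n = + a n n

-- "f = 1 / sqrt(g)" as formal power series with the branch equal to 1 at 0:
-- f has constant term 1 and f² · g = 1.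
IsInvSqrt : Series → Series → Set
IsInvSqrt f g = (f 0 ≡ + 1) × (∀ n → ((f ⊛ f) ⊛ g) n ≡ one n)
  where open import Relation.Binary.PropositionalEquality using (_≡_)

{-# OPTIONS --safe #-}
module Submission where

-- Let a′(p,q) count the matchings in which the leftmost point f₀ of the first line is not joined to its
-- neighbour f₁. In those, the leftmost point s₀ of the second line is joined to its neighbour s₁ or to f₀, as any
-- other partner would enclose a point or create a crossing. Removing the leftmost pair gives
-- a(p,q) = a′(p,q) + a(p−2,q) and a′(p,q) = a(p−1,q−1) + a′(p,q−2), hence, reading a as 0 at negative indices,
--   a(p,q) + a(p−2,q−2) = [p = q = 0] + a(p−1,q−1) + a(p,q−2) + a(p−2,q),
-- a recurrence which also forces a(p,q) = a(q,p). For the diagonals Z_d = Σ_j a(d+j,j) xʲ and α = 1 − x + x²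
-- it says α Z_{d+2} = x² Z_{d+4} + Z_d and α Z_0 = 1 + 2x² Z_2. Consequently
-- J_d = Z_d² + x² Z_{d+2}² − α Z_d Z_{d+2} satisfies J_d = x² J_{d+2}, so J_0 is divisible by every power of x
-- and vanishes. As 1 − 2x − x² − 2x³ + x⁴ = α² − 4x², these two facts give Z_0² (α² − 4x²) = 1.

open import Defs
open import Data.Nat.Base using (ℕ)

module PowerSeries where

  open import Data.Nat.Base using (zero; suc; _∸_)
  open import Data.Integer.Base using (ℤ; +_; -_; _+_; _*_; +-*-rawRing)
  import Data.Integer.Properties as ℤ
  open import Data.Integer.Solver using (module +-*-Solver)
  open import Data.Maybe.Base using (Maybe; just; nothing)
  open import Data.Product.Base using (_,_)
  open import Function.Base using (_∘_)
  open import Algebra.Bundles using (CommutativeRing)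
  open import Algebra.Structures using (IsCommutativeRing)
  open import Algebra.Solver.Ring.AlmostCommutativeRing
    using (fromCommutativeRing; _-Raw-AlmostCommutative⟶_)
  import Algebra.Solver.Ring
  open import Relation.Binary.PropositionalEquality
  open import Relation.Nullary.Decidable.Core using (yes; no)
  open ≡-Reasoning

  infixl 6 _+ₛ_
  infix  8 -ₛ_
  infixr 7 _·_

  _+ₛ_ : Series → Series → Series
  (f +ₛ g) n = f n + g n

  -ₛ_ : Series → Series
  (-ₛ f) n = - f n

  0ₛ : Series
  0ₛ _ = + 0

  const : ℤ → Series
  const c zero    = c
  const c (suc _) = + 0

  _·_ : ℤ → Series → Series
  (c · f) n = c * f n

  tail : Series → Series
  tail f n = f (suc n)

  sumTo-suc : ∀ n (h : ℕ → ℤ) → sumTo (suc n) h ≡ h 0 + sumTo n (h ∘ suc)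
  sumTo-suc zero    h = refl
  sumTo-suc (suc n) h = begin
    sumTo (suc n) h + h (suc (suc n))           ≡⟨ cong (_+ h (suc (suc n))) (sumTo-suc n h) ⟩
    h 0 + sumTo n (h ∘ suc) + h (suc (suc n))   ≡⟨ ℤ.+-assoc (h 0) _ _ ⟩
    h 0 + sumTo (suc n) (h ∘ suc)               ∎

  ⊛-suc : ∀ f g n → (f ⊛ g) (suc n) ≡ f 0 * g (suc n) + (tail f ⊛ g) n
  ⊛-suc f g n = sumTo-suc n (λ k → f k * g (suc n ∸ k))

  open +-*-Solver


  ⊛-sucʳ : ∀ f g n → (f ⊛ g) (suc n) ≡ f (suc n) * g 0 + (f ⊛ tail g) n
  ⊛-sucʳ f g zero    = trans (⊛-suc f g 0) (ℤ.+-comm (f 0 * g 1) (f 1 * g 0))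
  ⊛-sucʳ f g (suc n) = begin
    (f ⊛ g) (suc m)                                   ≡⟨ ⊛-suc f g m ⟩
    f 0 * g (suc m) + (tail f ⊛ g) m                  ≡⟨ cong (_+_ (f 0 * g (suc m))) (⊛-sucʳ (tail f) g n) ⟩
    f 0 * g (suc m) + (f (suc m) * g 0 + (tail f ⊛ tail g) n)
      ≡⟨ solve 3 (λ x y z → x :+ (y :+ z) := y :+ (x :+ z)) refl (f 0 * g (suc m)) (f (suc m) * g 0) _ ⟩
    f (suc m) * g 0 + (f 0 * g (suc m) + (tail f ⊛ tail g) n) ≡⟨ cong (_+_ (f (suc m) * g 0)) (⊛-suc f (tail g) n) ⟨
    f (suc m) * g 0 + (f ⊛ tail g) m                  ∎
    where
    m : ℕ
    m = suc n

  ⊛-cong : ∀ {f f′ g g′} → f ≗ f′ → g ≗ g′ → f ⊛ g ≗ f′ ⊛ g′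
  ⊛-cong f≗f′ g≗g′ zero    = cong₂ _*_ (f≗f′ 0) (g≗g′ 0)
  ⊛-cong {f} {f′} {g} {g′} f≗f′ g≗g′ (suc n) = begin
    (f ⊛ g) (suc n)                        ≡⟨ ⊛-suc f g n ⟩
    f 0 * g (suc n) + (tail f ⊛ g) n
      ≡⟨ cong₂ _+_ (cong₂ _*_ (f≗f′ 0) (g≗g′ (suc n))) (⊛-cong (f≗f′ ∘ suc) g≗g′ n) ⟩
    f′ 0 * g′ (suc n) + (tail f′ ⊛ g′) n   ≡⟨ ⊛-suc f′ g′ n ⟨
    (f′ ⊛ g′) (suc n)                      ∎

  ⊛-comm : ∀ f g → f ⊛ g ≗ g ⊛ f
  ⊛-comm f g zero    = ℤ.*-comm (f 0) (g 0)
  ⊛-comm f g (suc n) = begin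
    (f ⊛ g) (suc n)                    ≡⟨ ⊛-suc f g n ⟩
    f 0 * g (suc n) + (tail f ⊛ g) n   ≡⟨ cong₂ _+_ (ℤ.*-comm (f 0) (g (suc n))) (⊛-comm (tail f) g n) ⟩
    g (suc n) * f 0 + (g ⊛ tail f) n   ≡⟨ ⊛-sucʳ g f n ⟨
    (g ⊛ f) (suc n)                    ∎

  0ₛ-⊛ : ∀ f → 0ₛ ⊛ f ≗ 0ₛ
  0ₛ-⊛ f zero    = refl
  0ₛ-⊛ f (suc n) = trans (⊛-suc 0ₛ f n) (cong (_+_ (+ 0 * f (suc n))) (0ₛ-⊛ f n))

  one-⊛ : ∀ f → one ⊛ f ≗ f
  one-⊛ f zero    = ℤ.*-identityˡ (f 0)
  one-⊛ f (suc n) = begin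
    (one ⊛ f) (suc n)                  ≡⟨ ⊛-suc one f n ⟩
    + 1 * f (suc n) + (0ₛ ⊛ f) n       ≡⟨ cong₂ _+_ (ℤ.*-identityˡ (f (suc n))) (0ₛ-⊛ f n) ⟩
    f (suc n) + + 0                    ≡⟨ ℤ.+-identityʳ _ ⟩
    f (suc n)                          ∎

  ⊛-distribˡ : ∀ f g h → f ⊛ (g +ₛ h) ≗ (f ⊛ g) +ₛ (f ⊛ h)
  ⊛-distribˡ f g h zero    = ℤ.*-distribˡ-+ (f 0) (g 0) (h 0)
  ⊛-distribˡ f g h (suc n) = begin
    (f ⊛ (g +ₛ h)) (suc n)                                     ≡⟨ ⊛-suc f (g +ₛ h) n ⟩
    f 0 * (g (suc n) + h (suc n)) + (tail f ⊛ (g +ₛ h)) n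
      ≡⟨ cong (_+_ (f 0 * (g (suc n) + h (suc n)))) (⊛-distribˡ (tail f) g h n) ⟩
    f 0 * (g (suc n) + h (suc n)) + ((tail f ⊛ g) n + (tail f ⊛ h) n)
      ≡⟨ solve 5 (λ x y z u v → x :* (y :+ z) :+ (u :+ v) := (x :* y :+ u) :+ (x :* z :+ v))
               refl (f 0) (g (suc n)) (h (suc n)) _ _ ⟩
    (f 0 * g (suc n) + (tail f ⊛ g) n) + (f 0 * h (suc n) + (tail f ⊛ h) n)
      ≡⟨ cong₂ _+_ (⊛-suc f g n) (⊛-suc f h n) ⟨
    ((f ⊛ g) +ₛ (f ⊛ h)) (suc n)                               ∎

  ⊛-distribʳ : ∀ f g h → (g +ₛ h) ⊛ f ≗ (g ⊛ f) +ₛ (h ⊛ f)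
  ⊛-distribʳ f g h n = begin
    ((g +ₛ h) ⊛ f) n             ≡⟨ ⊛-comm (g +ₛ h) f n ⟩
    (f ⊛ (g +ₛ h)) n             ≡⟨ ⊛-distribˡ f g h n ⟩
    (f ⊛ g) n + (f ⊛ h) n        ≡⟨ cong₂ _+_ (⊛-comm f g n) (⊛-comm f h n) ⟩
    (g ⊛ f) n + (h ⊛ f) n        ∎

  ·-⊛ : ∀ c f g → (c · f) ⊛ g ≗ c · (f ⊛ g)
  ·-⊛ c f g zero    = ℤ.*-assoc c (f 0) (g 0)
  ·-⊛ c f g (suc n) = begin
    ((c · f) ⊛ g) (suc n)                              ≡⟨ ⊛-suc (c · f) g n ⟩
    c * f 0 * g (suc n) + ((c · tail f) ⊛ g) n         ≡⟨ cong (_+_ (c * f 0 * g (suc n))) (·-⊛ c (tail f) g n) ⟩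
    c * f 0 * g (suc n) + c * (tail f ⊛ g) n
      ≡⟨ solve 4 (λ x y z u → x :* y :* z :+ x :* u := x :* (y :* z :+ u)) refl c (f 0) (g (suc n)) _ ⟩
    c * (f 0 * g (suc n) + (tail f ⊛ g) n)             ≡⟨ cong (c *_) (⊛-suc f g n) ⟨
    (c · (f ⊛ g)) (suc n)                              ∎

  ⊛-assoc : ∀ f g h → (f ⊛ g) ⊛ h ≗ f ⊛ (g ⊛ h)
  ⊛-assoc f g h zero    = ℤ.*-assoc (f 0) (g 0) (h 0)
  ⊛-assoc f g h (suc n) = begin
    ((f ⊛ g) ⊛ h) (suc n)                                         ≡⟨ ⊛-suc (f ⊛ g) h n ⟩
    c + (tail (f ⊛ g) ⊛ h) n
      ≡⟨ cong (_+_ c) (⊛-cong {g = h} (⊛-suc f g) (λ _ → refl) n) ⟩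
    c + (((f 0 · tail g) +ₛ (tail f ⊛ g)) ⊛ h) n
      ≡⟨ cong (_+_ c) (⊛-distribʳ h (f 0 · tail g) (tail f ⊛ g) n) ⟩
    c + (((f 0 · tail g) ⊛ h) n + ((tail f ⊛ g) ⊛ h) n)
      ≡⟨ cong (_+_ c) (cong₂ _+_ (·-⊛ (f 0) (tail g) h n) (⊛-assoc (tail f) g h n)) ⟩
    f 0 * g 0 * h (suc n) + (f 0 * (tail g ⊛ h) n + (tail f ⊛ (g ⊛ h)) n)
      ≡⟨ solve 5 (λ x y z u v → x :* y :* z :+ (x :* u :+ v) := x :* (y :* z :+ u) :+ v)
               refl (f 0) (g 0) (h (suc n)) _ _ ⟩
    f 0 * (g 0 * h (suc n) + (tail g ⊛ h) n) + (tail f ⊛ (g ⊛ h)) n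
      ≡⟨ cong (λ t → f 0 * t + (tail f ⊛ (g ⊛ h)) n) (⊛-suc g h n) ⟨
    f 0 * (g ⊛ h) (suc n) + (tail f ⊛ (g ⊛ h)) n                  ≡⟨ ⊛-suc f (g ⊛ h) n ⟨
    (f ⊛ (g ⊛ h)) (suc n)                                         ∎
    where
    c : ℤ
    c = f 0 * g 0 * h (suc n)

  isCommutativeRing : IsCommutativeRing _≗_ _+ₛ_ _⊛_ -ₛ_ 0ₛ one
  isCommutativeRing = record
    { isRing = record
      { +-isAbelianGroup = record
        { isGroup = record
          { isMonoid = record
            { isSemigroup = record
              { isMagma = record
                { isEquivalence = record
                  { refl = λ _ → refl ; sym = λ p n → sym (p n) ; trans = λ p q n → trans (p n) (q n) }
                ; ∙-cong = λ p q n → cong₂ _+_ (p n) (q n) }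
              ; assoc = λ f g h n → ℤ.+-assoc (f n) (g n) (h n) }
            ; identity = (λ f n → ℤ.+-identityˡ (f n)) , (λ f n → ℤ.+-identityʳ (f n)) }
          ; inverse = (λ f n → ℤ.+-inverseˡ (f n)) , (λ f n → ℤ.+-inverseʳ (f n))
          ; ⁻¹-cong = λ p n → cong -_ (p n) }
        ; comm = λ f g n → ℤ.+-comm (f n) (g n) }
      ; *-cong = ⊛-cong
      ; *-assoc = ⊛-assoc
      ; *-identity = one-⊛ , (λ f n → trans (⊛-comm f one n) (one-⊛ f n))
      ; distrib = ⊛-distribˡ , ⊛-distribʳ }
    ; *-comm = ⊛-comm }

  commutativeRing : CommutativeRing _ _
  commutativeRing = record { isCommutativeRing = isCommutativeRing }

  const-⊛ : ∀ c d → const (c * d) ≗ const c ⊛ const d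
  const-⊛ c d zero    = refl
  const-⊛ c d (suc n) = sym (begin
    (const c ⊛ const d) (suc n)                  ≡⟨ ⊛-suc (const c) (const d) n ⟩
    c * + 0 + (0ₛ ⊛ const d) n                   ≡⟨ cong₂ _+_ (ℤ.*-zeroʳ c) (0ₛ-⊛ (const d) n) ⟩
    + 0                                          ∎)

  const-homomorphism : +-*-rawRing -Raw-AlmostCommutative⟶ fromCommutativeRing commutativeRing
  const-homomorphism = record
    { ⟦_⟧    = const
    ; +-homo = λ c d → λ { zero → refl ; (suc _) → refl }
    ; *-homo = const-⊛
    ; -‿homo = λ c → λ { zero → refl ; (suc _) → refl }
    ; 0-homo = λ { zero → refl ; (suc _) → refl }
    ; 1-homo = λ { zero → refl ; (suc _) → refl }
    }

  const-≟ : ∀ c d → Maybe (const c ≗ const d)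
  const-≟ c d with c ℤ.≟ d
  ... | yes refl = just (λ _ → refl)
  ... | no _     = nothing

  ≗⇒difference≗0ₛ : ∀ {f g} → f ≗ g → f +ₛ -ₛ g ≗ 0ₛ
  ≗⇒difference≗0ₛ {g = g} f≗g n = trans (cong (_+ - g n) (f≗g n)) (ℤ.+-inverseʳ (g n))

  IsInvSqrt-cong : ∀ {f g h} → f ≗ g → IsInvSqrt g h → IsInvSqrt f h
  IsInvSqrt-cong {h = h} f≗g (g₀≡1 , g²h≗1) =
    trans (f≗g 0) g₀≡1 , λ n → trans (⊛-cong {g = h} (⊛-cong f≗g f≗g) (λ _ → refl) n) (g²h≗1 n)

  module RingSolver = Algebra.Solver.Ring +-*-rawRing (fromCommutativeRing commutativeRing)
                                          const-homomorphism const-≟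

  X : Series
  X 1 = + 1
  X _ = + 0

  X⊛-suc : ∀ f n → (X ⊛ f) (suc n) ≡ f n
  X⊛-suc f n = begin
    (X ⊛ f) (suc n)                    ≡⟨ ⊛-suc X f n ⟩
    + 0 * f (suc n) + (tail X ⊛ f) n   ≡⟨ ℤ.+-identityˡ ((tail X ⊛ f) n) ⟩
    (tail X ⊛ f) n                     ≡⟨ ⊛-cong {g = f} tail-X (λ _ → refl) n ⟩
    (one ⊛ f) n                        ≡⟨ one-⊛ f n ⟩
    f n                                ∎
    where
    tail-X : tail X ≗ one
    tail-X zero    = refl
    tail-X (suc _) = refl

  horner-suc : ∀ c f n → (const c +ₛ X ⊛ f) (suc n) ≡ f n
  horner-suc c f n = trans (ℤ.+-identityˡ _) (X⊛-suc f n)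

  X²-chain⇒≗0ₛ : ∀ {I : Set} (F : I → Series) (next : I → I) →
                   (∀ i → F i ≗ X ⊛ (X ⊛ F (next i))) → ∀ i → F i ≗ 0ₛ
  X²-chain⇒≗0ₛ F next F≗X²F i zero          = F≗X²F i 0
  X²-chain⇒≗0ₛ F next F≗X²F i (suc zero)    = trans (F≗X²F i 1) (X⊛-suc (X ⊛ F (next i)) 0)
  X²-chain⇒≗0ₛ F next F≗X²F i (suc (suc n)) = begin
    F i (suc (suc n))                         ≡⟨ F≗X²F i (suc (suc n)) ⟩
    (X ⊛ (X ⊛ F (next i))) (suc (suc n))      ≡⟨ X⊛-suc (X ⊛ F (next i)) (suc n) ⟩
    (X ⊛ F (next i)) (suc n)                  ≡⟨ X⊛-suc (F (next i)) n ⟩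
    F (next i) n                              ≡⟨ X²-chain⇒≗0ₛ F next F≗X²F (next i) n ⟩
    + 0                                       ∎

module PaddedRecurrence where

  open import Data.Nat.Base using (zero; suc; _+_)
  import Data.Nat.Properties as ℕ
  open import Algebra.Properties.CommutativeSemigroup ℕ.+-commutativeSemigroup using (xy∙z≈xz∙y)
  open import Relation.Binary.PropositionalEquality
  open ≡-Reasoning

  δ : ℕ → ℕ → ℕ
  δ zero zero = 1
  δ _    _    = 0

  δ-sym : ∀ p q → δ p q ≡ δ q p
  δ-sym zero    zero    = refl
  δ-sym zero    (suc _) = refl
  δ-sym (suc _) zero    = refl
  δ-sym (suc _) (suc _) = refl

  pad : (ℕ → ℕ → ℕ) → ℕ → ℕ → ℕ
  pad A p             zero          = 0
  pad A p             (suc zero)    = 0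
  pad A zero          (suc (suc q)) = 0
  pad A (suc zero)    (suc (suc q)) = 0
  pad A (suc (suc p)) (suc (suc q)) = A p q

  Recurrence : (ℕ → ℕ → ℕ) → Set
  Recurrence A = ∀ p q →
    A p q + pad A p q ≡ δ p q + pad A (suc p) (suc q) + pad A (suc (suc p)) q + pad A p (suc (suc q))

  module _ {A : ℕ → ℕ → ℕ} (rec : Recurrence A) where

    -- The recurrence determines A p q from values at lexicographically smaller (p, q), and is invariant
    -- under exchanging p and q.
    pad-sym : ∀ p q → pad A p q ≡ pad A q p
    pad-sym zero                zero                = refl
    pad-sym zero                (suc zero)          = refl
    pad-sym zero                (suc (suc q))       = refl
    pad-sym (suc zero)          zero                = refl
    pad-sym (suc zero)          (suc zero)          = refl
    pad-sym (suc zero)          (suc (suc q))       = refl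
    pad-sym (suc (suc p))       zero                = refl
    pad-sym (suc (suc p))       (suc zero)          = refl
    pad-sym (suc (suc p))       (suc (suc q))       =
      ℕ.+-cancelʳ-≡ (pad A p q) (A p q) (A q p) (begin
        A p q + pad A p q
          ≡⟨ rec p q ⟩
        δ p q + pad A (suc p) (suc q) + pad A (suc (suc p)) q + pad A p (suc (suc q))
          ≡⟨ cong₂ _+_ (cong₂ _+_ (cong₂ _+_ (δ-sym p q) (pad-sym (suc p) (suc q)))
                                  (pad-sym (suc (suc p)) q))
                       (pad-sym p (suc (suc q))) ⟩
        δ q p + pad A (suc q) (suc p) + pad A q (suc (suc p)) + pad A (suc (suc q)) p
          ≡⟨ xy∙z≈xz∙y (δ q p + pad A (suc q) (suc p)) _ _ ⟩
        δ q p + pad A (suc q) (suc p) + pad A (suc (suc q)) p + pad A q (suc (suc p))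
          ≡⟨ rec q p ⟨
        A q p + pad A q p
          ≡⟨ cong (A q p +_) (pad-sym p q) ⟨
        A q p + pad A p q ∎)

    symmetric : ∀ p q → A p q ≡ A q p
    symmetric p q = pad-sym (suc (suc p)) (suc (suc q))

module DiagonalSeries where

  open import Data.Nat.Base as ℕ using (zero; suc)
  import Data.Nat.Properties as ℕ
  open import Data.Integer.Base using (+_; -_; _+_; _-_)
  import Data.Integer.Properties as ℤ
  open import Data.Product.Base using (_,_)
  open import Algebra.Bundles using (CommutativeRing)
  open import Relation.Binary.PropositionalEquality
  open PowerSeries
  open PaddedRecurrence
  open RingSolver using (solve; _:=_; con; _:+_; _:*_; :-_)
  module R = CommutativeRing commutativeRing

  α : Series
  α = const (+ 1) +ₛ -ₛ X +ₛ X ⊛ X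

  α⊛-expand : ∀ f → α ⊛ f ≗ f +ₛ -ₛ (X ⊛ f) +ₛ X ⊛ (X ⊛ f)
  α⊛-expand = solve 2 (λ x f → (con (+ 1) :+ :- x :+ x :* x) :* f := f :+ :- (x :* f) :+ x :* (x :* f))
                      (λ _ → refl) X

  α⊛-zero : ∀ f → (α ⊛ f) 0 ≡ f 0
  α⊛-zero f = ℤ.*-identityˡ (f 0)

  α⊛-one : ∀ f → (α ⊛ f) 1 ≡ f 1 - f 0
  α⊛-one f = trans (α⊛-expand f 1) (trans (cong (λ t → f 1 - t + + 0) (X⊛-suc f 0)) (ℤ.+-identityʳ _))

  α⊛-suc-suc : ∀ f j → (α ⊛ f) (suc (suc j)) ≡ f (suc (suc j)) - f (suc j) + f j
  α⊛-suc-suc f j = trans (α⊛-expand f (suc (suc j)))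
    (cong₂ (λ s t → f (suc (suc j)) - s + t) (X⊛-suc f (suc j)) (trans (X⊛-suc (X ⊛ f) (suc j)) (X⊛-suc f j)))

  P-horner : P ≗ const (+ 1) +ₛ X ⊛ (const (- + 2) +ₛ X ⊛ (const (- + 1) +ₛ X ⊛ (const (- + 2) +ₛ X ⊛ const (+ 1))))
  P-horner 0 = refl
  P-horner 1 = refl
  P-horner 2 = refl
  P-horner 3 = refl
  P-horner 4 = refl
  P-horner (suc (suc (suc (suc (suc n))))) = sym (begin
    (const (+ 1) +ₛ X ⊛ f₁) (5 ℕ.+ n)      ≡⟨ horner-suc (+ 1) f₁ (4 ℕ.+ n) ⟩
    (const (- + 2) +ₛ X ⊛ f₂) (4 ℕ.+ n)    ≡⟨ horner-suc (- + 2) f₂ (3 ℕ.+ n) ⟩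
    (const (- + 1) +ₛ X ⊛ f₃) (3 ℕ.+ n)    ≡⟨ horner-suc (- + 1) f₃ (2 ℕ.+ n) ⟩
    (const (- + 2) +ₛ X ⊛ f₄) (2 ℕ.+ n)    ≡⟨ horner-suc (- + 2) f₄ (1 ℕ.+ n) ⟩
    + 0                                  ∎)
    where
    open ≡-Reasoning
    f₁ f₂ f₃ f₄ : Series
    f₄ = const (+ 1)
    f₃ = const (- + 2) +ₛ X ⊛ f₄
    f₂ = const (- + 1) +ₛ X ⊛ f₃
    f₁ = const (- + 2) +ₛ X ⊛ f₂

  P-factorisation : P ≗ α ⊛ α +ₛ -ₛ (const (+ 4) ⊛ (X ⊛ X))
  P-factorisation = R.trans P-horner
    (solve 1 (λ x → con (+ 1) :+ x :* (con (- + 2) :+ x :* (con (- + 1) :+ x :* (con (- + 2) :+ x :* con (+ 1))))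
                    := (con (+ 1) :+ :- x :+ x :* x) :* (con (+ 1) :+ :- x :+ x :* x) :+ :- (con (+ 4) :* (x :* x)))
           (λ _ → refl) X)

  pos-u-v+w≡y : ∀ u v w y → u ℕ.+ w ≡ v ℕ.+ y → + u - + v + + w ≡ + y
  pos-u-v+w≡y u v w y eq = begin
    + u - + v + + w      ≡⟨ ℤ-solve 3 (λ a b c → a :-ℤ b :+ℤ c :=ℤ a :+ℤ c :-ℤ b) refl (+ u) (+ v) (+ w) ⟩
    + u + + w - + v      ≡⟨ cong (_- + v) (ℤ.pos-+ u w) ⟨
    + (u ℕ.+ w) - + v    ≡⟨ cong (λ t → + t - + v) eq ⟩
    + (v ℕ.+ y) - + v    ≡⟨ cong (_- + v) (ℤ.pos-+ v y) ⟩
    + v + + y - + v      ≡⟨ ℤ-solve 2 (λ a b → a :+ℤ b :-ℤ a :=ℤ b) refl (+ v) (+ y) ⟩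
    + y                  ∎
    where
    open ≡-Reasoning
    open import Data.Integer.Solver using (module +-*-Solver)
    open +-*-Solver using () renaming (solve to ℤ-solve; _:=_ to _:=ℤ_; _:+_ to _:+ℤ_; _:-_ to _:-ℤ_)

  module _ {A : ℕ → ℕ → ℕ} (rec : Recurrence A) where

    diagonal : ℕ → Series
    diagonal d j = + A (d ℕ.+ j) j

    A₀₀≡1 : A 0 0 ≡ 1
    A₀₀≡1 = trans (sym (ℕ.+-identityʳ (A 0 0))) (rec 0 0)

    diagonal-step : ∀ d → α ⊛ diagonal (suc (suc d)) ≗ X ⊛ (X ⊛ diagonal (4 ℕ.+ d)) +ₛ diagonal d
    diagonal-step d zero = trans (α⊛-zero (diagonal (suc (suc d))))
      (cong +_ (trans (sym (ℕ.+-identityʳ _)) (rec (suc (suc (d ℕ.+ 0))) 0)))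
    diagonal-step d (suc zero) = trans (α⊛-one (diagonal (suc (suc d)))) (coefficient₁ d)
      where
      coefficient₁ : ∀ d → + A (suc (suc (d ℕ.+ 1))) 1 - + A (suc (suc (d ℕ.+ 0))) 0 ≡ + A (d ℕ.+ 1) 1
      coefficient₁ d rewrite ℕ.+-suc d 0 = trans (sym (ℤ.+-identityʳ _))
        (pos-u-v+w≡y (A (3 ℕ.+ k) 1) (A (2 ℕ.+ k) 0) 0 (A (1 ℕ.+ k) 1)
                  (trans (rec (3 ℕ.+ k) 1) (cong (ℕ._+ A (1 ℕ.+ k) 1) (ℕ.+-identityʳ _))))
        where
        k : ℕ
        k = d ℕ.+ 0
    diagonal-step d (suc (suc j)) = begin
      (α ⊛ diagonal (suc (suc d))) (suc (suc j))
        ≡⟨ α⊛-suc-suc (diagonal (suc (suc d))) j ⟩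
      + A (suc (suc d) ℕ.+ suc (suc j)) (suc (suc j)) - + A (suc (suc d) ℕ.+ suc j) (suc j)
        + + A (suc (suc d) ℕ.+ j) j
        ≡⟨ coefficient d j ⟩
      + A (4 ℕ.+ d ℕ.+ j) j + + A (d ℕ.+ suc (suc j)) (suc (suc j))
        ≡⟨ cong (_+ diagonal d (suc (suc j)))
                (trans (X⊛-suc (X ⊛ diagonal (4 ℕ.+ d)) (suc j)) (X⊛-suc (diagonal (4 ℕ.+ d)) j)) ⟨
      (X ⊛ (X ⊛ diagonal (4 ℕ.+ d)) +ₛ diagonal d) (suc (suc j)) ∎
      where
      open ≡-Reasoning
      coefficient : ∀ d j →
        + A (suc (suc d) ℕ.+ suc (suc j)) (suc (suc j)) - + A (suc (suc d) ℕ.+ suc j) (suc j) + + A (suc (suc d) ℕ.+ j) j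
        ≡ + A (4 ℕ.+ d ℕ.+ j) j + + A (d ℕ.+ suc (suc j)) (suc (suc j))
      coefficient d j rewrite ℕ.+-suc d (suc j) | ℕ.+-suc d j =
        pos-u-v+w≡y (A (4 ℕ.+ k) (2 ℕ.+ j)) (A (3 ℕ.+ k) (suc j)) (A (2 ℕ.+ k) j)
                    (A (4 ℕ.+ k) j ℕ.+ A (2 ℕ.+ k) (2 ℕ.+ j))
          (trans (rec (4 ℕ.+ k) (2 ℕ.+ j))
                 (ℕ.+-assoc (A (3 ℕ.+ k) (suc j)) (A (4 ℕ.+ k) j) (A (2 ℕ.+ k) (2 ℕ.+ j))))
        where
        k : ℕ
        k = d ℕ.+ j

    diagonal-start : α ⊛ diagonal 0 ≗ const (+ 1) +ₛ X ⊛ (X ⊛ (diagonal 2 +ₛ diagonal 2))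
    diagonal-start zero = trans (α⊛-zero (diagonal 0)) (cong +_ A₀₀≡1)
    diagonal-start (suc zero) = begin
      (α ⊛ diagonal 0) 1     ≡⟨ α⊛-one (diagonal 0) ⟩
      + A 1 1 - + A 0 0      ≡⟨ cong (λ t → + t - + A 0 0) A₁₁≡A₀₀ ⟩
      + A 0 0 - + A 0 0      ≡⟨ ℤ.+-inverseʳ (+ A 0 0) ⟩
      + 0                    ∎
      where
      open ≡-Reasoning
      A₁₁≡A₀₀ : A 1 1 ≡ A 0 0
      A₁₁≡A₀₀ = trans (sym (ℕ.+-identityʳ _)) (trans (rec 1 1) (trans (ℕ.+-identityʳ _) (ℕ.+-identityʳ _)))
    diagonal-start (suc (suc j)) = begin
      (α ⊛ diagonal 0) (suc (suc j))
        ≡⟨ α⊛-suc-suc (diagonal 0) j ⟩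
      + A (2 ℕ.+ j) (2 ℕ.+ j) - + A (suc j) (suc j) + + A j j
        ≡⟨ pos-u-v+w≡y (A (2 ℕ.+ j) (2 ℕ.+ j)) (A (suc j) (suc j)) (A j j) (A (2 ℕ.+ j) j ℕ.+ A (2 ℕ.+ j) j) (begin
             A (2 ℕ.+ j) (2 ℕ.+ j) ℕ.+ A j j
               ≡⟨ rec (2 ℕ.+ j) (2 ℕ.+ j) ⟩
             A (suc j) (suc j) ℕ.+ A (2 ℕ.+ j) j ℕ.+ A j (2 ℕ.+ j)
               ≡⟨ ℕ.+-assoc (A (suc j) (suc j)) _ _ ⟩
             A (suc j) (suc j) ℕ.+ (A (2 ℕ.+ j) j ℕ.+ A j (2 ℕ.+ j))
               ≡⟨ cong (λ t → A (suc j) (suc j) ℕ.+ (A (2 ℕ.+ j) j ℕ.+ t)) (symmetric rec j (2 ℕ.+ j)) ⟩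
             A (suc j) (suc j) ℕ.+ (A (2 ℕ.+ j) j ℕ.+ A (2 ℕ.+ j) j) ∎) ⟩
      (diagonal 2 +ₛ diagonal 2) j
        ≡⟨ trans (ℤ.+-identityˡ _) (trans (X⊛-suc (X ⊛ (diagonal 2 +ₛ diagonal 2)) (suc j))
                                          (X⊛-suc (diagonal 2 +ₛ diagonal 2) j)) ⟨
      (const (+ 1) +ₛ X ⊛ (X ⊛ (diagonal 2 +ₛ diagonal 2))) (suc (suc j)) ∎
      where open ≡-Reasoning

    invariant : ℕ → Series
    invariant d = diagonal d ⊛ diagonal d +ₛ X ⊛ (X ⊛ (diagonal (2 ℕ.+ d) ⊛ diagonal (2 ℕ.+ d)))
                  +ₛ -ₛ (α ⊛ (diagonal d ⊛ diagonal (2 ℕ.+ d)))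

    invariant-step : ∀ d → invariant d ≗ X ⊛ (X ⊛ invariant (2 ℕ.+ d))
    invariant-step d = begin
      invariant d
        ≈⟨ solve 5 (λ a x y₀ y₂ y₄ →
             y₀ :* y₀ :+ x :* (x :* (y₂ :* y₂)) :+ :- (a :* (y₀ :* y₂))
             := x :* (x :* (y₂ :* y₂ :+ x :* (x :* (y₄ :* y₄)) :+ :- (a :* (y₂ :* y₄))))
                :+ (x :* (x :* y₄) :+ :- y₀) :* (a :* y₂ :+ :- (x :* (x :* y₄) :+ y₀)))
             (λ _ → refl) α X (diagonal d) (diagonal (2 ℕ.+ d)) (diagonal (4 ℕ.+ d)) ⟩
      X ⊛ (X ⊛ invariant (2 ℕ.+ d))
        +ₛ c ⊛ (α ⊛ diagonal (2 ℕ.+ d) +ₛ -ₛ (X ⊛ (X ⊛ diagonal (4 ℕ.+ d)) +ₛ diagonal d))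
        ≈⟨ R.+-congˡ {X ⊛ (X ⊛ invariant (2 ℕ.+ d))} (R.*-congˡ {c} (≗⇒difference≗0ₛ (diagonal-step d))) ⟩
      X ⊛ (X ⊛ invariant (2 ℕ.+ d)) +ₛ c ⊛ 0ₛ
        ≈⟨ R.trans (R.+-congˡ {X ⊛ (X ⊛ invariant (2 ℕ.+ d))} (R.zeroʳ c)) (R.+-identityʳ _) ⟩
      X ⊛ (X ⊛ invariant (2 ℕ.+ d)) ∎
      where
      open import Relation.Binary.Reasoning.Setoid R.setoid
      c : Series
      c = X ⊛ (X ⊛ diagonal (4 ℕ.+ d)) +ₛ -ₛ diagonal d

    diagonal²⊛P≗one : (diagonal 0 ⊛ diagonal 0) ⊛ P ≗ one
    diagonal²⊛P≗one = begin
      (diagonal 0 ⊛ diagonal 0) ⊛ P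
        ≈⟨ R.*-congˡ {diagonal 0 ⊛ diagonal 0} P-factorisation ⟩
      (diagonal 0 ⊛ diagonal 0) ⊛ (α ⊛ α +ₛ -ₛ (const (+ 4) ⊛ (X ⊛ X)))
        ≈⟨ solve 4 (λ a x y₀ y₂ →
             (y₀ :* y₀) :* (a :* a :+ :- (con (+ 4) :* (x :* x)))
             := con (+ 1) :+ (con (- + 4) :* (x :* x)) :* (y₀ :* y₀ :+ x :* (x :* (y₂ :* y₂)) :+ :- (a :* (y₀ :* y₂)))
                :+ (a :* y₀ :+ :- (con (+ 1) :+ x :* (x :* (y₂ :+ y₂))))
                   :* (con (+ 2) :+ (a :* y₀ :+ :- (con (+ 1) :+ x :* (x :* (y₂ :+ y₂))))))
             (λ _ → refl) α X (diagonal 0) (diagonal 2) ⟩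
      const (+ 1) +ₛ (const (- + 4) ⊛ (X ⊛ X)) ⊛ invariant 0 +ₛ residual ⊛ (const (+ 2) +ₛ residual)
        ≈⟨ R.+-cong (R.+-congˡ {const (+ 1)} (R.trans (R.*-congˡ {const (- + 4) ⊛ (X ⊛ X)} invariant-vanishes)
                                                      (R.zeroʳ (const (- + 4) ⊛ (X ⊛ X)))))
                    (R.trans (R.*-congʳ {const (+ 2) +ₛ residual} (≗⇒difference≗0ₛ diagonal-start))
                             (R.zeroˡ (const (+ 2) +ₛ residual))) ⟩
      const (+ 1) +ₛ 0ₛ +ₛ 0ₛ
        ≈⟨ (λ { zero → refl ; (suc _) → refl }) ⟩
      one ∎
      where
      open import Relation.Binary.Reasoning.Setoid R.setoid
      invariant-vanishes : invariant 0 ≗ 0ₛ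
      invariant-vanishes = X²-chain⇒≗0ₛ invariant (2 ℕ.+_) invariant-step 0
      residual : Series
      residual = α ⊛ diagonal 0 +ₛ -ₛ (const (+ 1) +ₛ X ⊛ (X ⊛ (diagonal 2 +ₛ diagonal 2)))

    Recurrence⇒IsInvSqrt : IsInvSqrt (diagonal 0) P
    Recurrence⇒IsInvSqrt = cong +_ A₀₀≡1 , diagonal²⊛P≗one

module Counting where

  open import Data.Bool.Base using (Bool; if_then_else_)
  open import Data.Nat.Base using (suc; _+_)
  open import Data.Nat.ListAction using (sum)
  open import Data.Nat.ListAction.Properties using (sum-++)
  import Data.Nat.Properties as ℕ
  open import Algebra.Properties.CommutativeSemigroup ℕ.+-commutativeSemigroup using (interchange)
  open import Data.List.Base using (List; []; _∷_; _++_; map; concatMap; length)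
  open import Data.List.Properties using (map-++; map-∘)
  open import Data.List.Relation.Unary.All using (All; []; _∷_)
  open import Function.Base using (_∘_)
  open import Relation.Nullary using (¬_; does)
  open import Relation.Nullary.Decidable using (dec-true; dec-false)
  open import Relation.Unary using (Decidable)
  open import Relation.Binary.PropositionalEquality

  indicator : Bool → ℕ
  indicator b = if b then 1 else 0

  count : ∀ {A : Set} {Q : A → Set} → Decidable Q → List A → ℕ
  count Q? xs = sum (map (λ x → indicator (does (Q? x))) xs)

  module _ {A : Set} {Q : A → Set} (Q? : Decidable Q) where

    count-++ : ∀ xs ys → count Q? (xs ++ ys) ≡ count Q? xs + count Q? ys
    count-++ xs ys = trans (cong sum (map-++ _ xs ys)) (sum-++ (map _ xs) (map _ ys))

    count-map : ∀ {B : Set} (f : B → A) xs → count Q? (map f xs) ≡ count (Q? ∘ f) xs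
    count-map f xs = cong sum (sym (map-∘ xs))

    count-none : ∀ {xs} → All (¬_ ∘ Q) xs → count Q? xs ≡ 0
    count-none []           = refl
    count-none {x ∷ _} (¬Qx ∷ ¬Qxs) rewrite dec-false (Q? x) ¬Qx = count-none ¬Qxs

    count-single : ∀ {x} → Q x → count Q? (x ∷ []) ≡ 1
    count-single {x} Qx rewrite dec-true (Q? x) Qx = refl

    count-concatMap : ∀ {B : Set} (F : B → List A) xs → count Q? (concatMap F xs) ≡ sum (map (count Q? ∘ F) xs)
    count-concatMap F []       = refl
    count-concatMap F (x ∷ xs) = trans (count-++ (F x) (concatMap F xs)) (cong (count Q? (F x) +_) (count-concatMap F xs))

  sum-map-+ : ∀ {A : Set} (f g : A → ℕ) xs → sum (map (λ x → f x + g x) xs) ≡ sum (map f xs) + sum (map g xs)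
  sum-map-+ f g []       = refl
  sum-map-+ f g (x ∷ xs) = trans (cong (f x + g x +_) (sum-map-+ f g xs)) (interchange (f x) (g x) _ _)

  sum-map-zero : ∀ {A : Set} (xs : List A) → sum (map (λ _ → 0) xs) ≡ 0
  sum-map-zero []       = refl
  sum-map-zero (_ ∷ xs) = sum-map-zero xs

  sum-map-swap : ∀ {A B : Set} (h : A → B → ℕ) xs ys →
                 sum (map (λ x → sum (map (h x) ys)) xs) ≡ sum (map (λ y → sum (map (λ x → h x y) xs)) ys)
  sum-map-swap h []       ys = sym (sum-map-zero ys)
  sum-map-swap h (x ∷ xs) ys =
    trans (cong (sum (map (h x) ys) +_) (sum-map-swap h xs ys)) (sym (sum-map-+ (h x) _ ys))

  sum-map-1 : ∀ {A : Set} (xs : List A) → sum (map (λ _ → 1) xs) ≡ length xs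
  sum-map-1 []       = refl
  sum-map-1 (_ ∷ xs) = cong suc (sum-map-1 xs)

module Matchings where

  open import Data.Bool.Base using (true; false; not; _∧_; _∨_)
  open import Data.Nat.Base using (zero; suc; _+_; _∸_; _<_; _≤_; _<ᵇ_; _≤ᵇ_; _⊓_; _⊔_)
  import Data.Nat.Properties as ℕ
  open import Data.Product.Base using (_,_)
  open import Function.Base using (_∘_)
  open import Relation.Nullary using (¬_)
  open import Relation.Unary using (Decidable)
  open import Relation.Binary.PropositionalEquality
  open ≡-Reasoning

  Marked : ℕ → ℕ → Point → Set
  Marked p q (false , k) = k < p
  Marked p q (true  , k) = k < q

  -- A matching given by its partner map; φ is irrelevant off the marked points.
  record Admissible (p q : ℕ) (φ : Point → Point) : Set where
    field
      closed        : ∀ u → Marked p q u → Marked p q (φ u)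
      involutive    : ∀ u → Marked p q u → φ (φ u) ≡ u
      fixpoint-free : ∀ u → Marked p q u → φ u ≢ u
      disjoint      : ∀ u v → Marked p q u → Marked p q v → v ≢ u → v ≢ φ u →
                      meet (u , φ u) (v , φ v) ≡ false

  open Admissible public

  partner-partner : ∀ {p q φ} → Admissible p q φ → ∀ {u v} → Marked p q u → φ u ≡ v → φ v ≡ u
  partner-partner adm {u} hu refl = involutive adm u hu

  partner-marked : ∀ {p q φ} → Admissible p q φ → ∀ {u v} → Marked p q u → φ u ≡ v → Marked p q v
  partner-marked adm {u} hu refl = closed adm u hu

  Marked-≤ : ∀ {p q} l {j k} → j ≤ k → Marked p q (l , k) → Marked p q (l , j)
  Marked-≤ false j≤k = ℕ.≤-<-trans j≤k
  Marked-≤ true  j≤k = ℕ.≤-<-trans j≤k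

  shift : ℕ → ℕ → Point → Point
  shift m n (false , k) = false , m + k
  shift m n (true  , k) = true  , n + k

  unshift : ℕ → ℕ → Point → Point
  unshift m n (false , k) = false , k ∸ m
  unshift m n (true  , k) = true  , k ∸ n

  Shifted : ℕ → ℕ → Point → Set
  Shifted m n (false , k) = m ≤ k
  Shifted m n (true  , k) = n ≤ k

  Shifted? : ∀ m n → Decidable (Shifted m n)
  Shifted? m n (false , k) = m ℕ.≤? k
  Shifted? m n (true  , k) = n ℕ.≤? k

  shift-Shifted : ∀ m n u → Shifted m n (shift m n u)
  shift-Shifted m n (false , k) = ℕ.m≤m+n m k
  shift-Shifted m n (true  , k) = ℕ.m≤m+n n k

  unshift-shift : ∀ m n u → unshift m n (shift m n u) ≡ u
  unshift-shift m n (false , k) = cong (false ,_) (ℕ.m+n∸m≡n m k)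
  unshift-shift m n (true  , k) = cong (true ,_) (ℕ.m+n∸m≡n n k)

  shift-unshift : ∀ m n u → Shifted m n u → shift m n (unshift m n u) ≡ u
  shift-unshift m n (false , k) m≤k = cong (false ,_) (ℕ.m+[n∸m]≡n m≤k)
  shift-unshift m n (true  , k) n≤k = cong (true ,_) (ℕ.m+[n∸m]≡n n≤k)

  shift-injective : ∀ m n {u v} → shift m n u ≡ shift m n v → u ≡ v
  shift-injective m n {u} {v} eq =
    trans (sym (unshift-shift m n u)) (trans (cong (unshift m n) eq) (unshift-shift m n v))

  shift-marked : ∀ m n {p q} u → Marked p q u → Marked (m + p) (n + q) (shift m n u)
  shift-marked m n (false , k) = ℕ.+-monoʳ-< m
  shift-marked m n (true  , k) = ℕ.+-monoʳ-< n

  shift-marked⁻¹ : ∀ m n {p q} w → Marked (m + p) (n + q) (shift m n w) → Marked p q w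
  shift-marked⁻¹ m n {p} (false , k) = ℕ.+-cancelˡ-< m k p
  shift-marked⁻¹ m n {q = q} (true , k) = ℕ.+-cancelˡ-< n k q

  unshift-marked : ∀ m n {p q} u → Shifted m n u → Marked (m + p) (n + q) u → Marked p q (unshift m n u)
  unshift-marked m n {p} {q} u sh hu =
    shift-marked⁻¹ m n (unshift m n u) (subst (Marked (m + p) (n + q)) (sym (shift-unshift m n u sh)) hu)

  <ᵇ-+ˡ : ∀ c x y → (c + x <ᵇ c + y) ≡ (x <ᵇ y)
  <ᵇ-+ˡ zero    x y = refl
  <ᵇ-+ˡ (suc c) x y = <ᵇ-+ˡ c x y

  ≤ᵇ-+ˡ : ∀ c x y → (c + x ≤ᵇ c + y) ≡ (x ≤ᵇ y)
  ≤ᵇ-+ˡ zero    x y = refl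
  ≤ᵇ-+ˡ (suc c) x y = trans (<ᵇ-suc (c + x) (c + y)) (≤ᵇ-+ˡ c x y)
    where
    <ᵇ-suc : ∀ m n → (m <ᵇ suc n) ≡ (m ≤ᵇ n)
    <ᵇ-suc zero    n = refl
    <ᵇ-suc (suc m) n = refl

  overlap-+ˡ : ∀ c x₁ x₂ x₃ x₄ →
    (((c + x₁) ⊓ (c + x₂)) ⊔ ((c + x₃) ⊓ (c + x₄)) ≤ᵇ ((c + x₁) ⊔ (c + x₂)) ⊓ ((c + x₃) ⊔ (c + x₄)))
    ≡ (((x₁ ⊓ x₂) ⊔ (x₃ ⊓ x₄)) ≤ᵇ ((x₁ ⊔ x₂) ⊓ (x₃ ⊔ x₄)))
  overlap-+ˡ c x₁ x₂ x₃ x₄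
    rewrite sym (ℕ.+-distribˡ-⊓ c x₁ x₂) | sym (ℕ.+-distribˡ-⊓ c x₃ x₄)
          | sym (ℕ.+-distribˡ-⊔ c x₁ x₂) | sym (ℕ.+-distribˡ-⊔ c x₃ x₄)
          | sym (ℕ.+-distribˡ-⊔ c (x₁ ⊓ x₂) (x₃ ⊓ x₄)) | sym (ℕ.+-distribˡ-⊓ c (x₁ ⊔ x₂) (x₃ ⊔ x₄))
    = ≤ᵇ-+ˡ c _ _

  between-+ˡ : ∀ c x₁ x₂ e →
    between ((c + x₁) ⊓ (c + x₂)) ((c + x₁) ⊔ (c + x₂)) (c + e) ≡ between (x₁ ⊓ x₂) (x₁ ⊔ x₂) e
  between-+ˡ c x₁ x₂ e
    rewrite sym (ℕ.+-distribˡ-⊓ c x₁ x₂) | sym (ℕ.+-distribˡ-⊔ c x₁ x₂)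
          | sym (ℕ.+-distribˡ-⊓ c (x₁ ⊓ x₂) (x₁ ⊔ x₂)) | sym (ℕ.+-distribˡ-⊔ c (x₁ ⊓ x₂) (x₁ ⊔ x₂))
          | ≤ᵇ-+ˡ c ((x₁ ⊓ x₂) ⊓ (x₁ ⊔ x₂)) e | ≤ᵇ-+ˡ c e ((x₁ ⊓ x₂) ⊔ (x₁ ⊔ x₂))
    = refl

  crossing-+ˡ : ∀ m n a₁ b₁ a₂ b₂ →
    not (((m + a₁ <ᵇ m + a₂) ∧ (n + b₁ <ᵇ n + b₂)) ∨ ((m + a₂ <ᵇ m + a₁) ∧ (n + b₂ <ᵇ n + b₁)))
    ≡ not (((a₁ <ᵇ a₂) ∧ (b₁ <ᵇ b₂)) ∨ ((a₂ <ᵇ a₁) ∧ (b₂ <ᵇ b₁)))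
  crossing-+ˡ m n a₁ b₁ a₂ b₂
    rewrite <ᵇ-+ˡ m a₁ a₂ | <ᵇ-+ˡ n b₁ b₂ | <ᵇ-+ˡ m a₂ a₁ | <ᵇ-+ˡ n b₂ b₁ = refl

  meet-shift : ∀ m n u w v z → meet (shift m n u , shift m n w) (shift m n v , shift m n z) ≡ meet (u , w) (v , z)
  meet-shift m n (false , x₁) (false , x₂) (false , x₃) (false , x₄) = overlap-+ˡ m x₁ x₂ x₃ x₄
  meet-shift m n (false , x₁) (false , x₂) (false , x₃) (true  , x₄) = between-+ˡ m x₁ x₂ x₃
  meet-shift m n (false , x₁) (false , x₂) (true  , x₃) (false , x₄) = between-+ˡ m x₁ x₂ x₄
  meet-shift m n (false , x₁) (false , x₂) (true  , x₃) (true  , x₄) = refl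
  meet-shift m n (false , x₁) (true  , x₂) (false , x₃) (false , x₄) = between-+ˡ m x₃ x₄ x₁
  meet-shift m n (false , x₁) (true  , x₂) (false , x₃) (true  , x₄) = crossing-+ˡ m n x₁ x₂ x₃ x₄
  meet-shift m n (false , x₁) (true  , x₂) (true  , x₃) (false , x₄) = crossing-+ˡ m n x₁ x₂ x₄ x₃
  meet-shift m n (false , x₁) (true  , x₂) (true  , x₃) (true  , x₄) = between-+ˡ n x₃ x₄ x₂
  meet-shift m n (true  , x₁) (false , x₂) (false , x₃) (false , x₄) = between-+ˡ m x₃ x₄ x₂
  meet-shift m n (true  , x₁) (false , x₂) (false , x₃) (true  , x₄) = crossing-+ˡ m n x₂ x₁ x₃ x₄
  meet-shift m n (true  , x₁) (false , x₂) (true  , x₃) (false , x₄) = crossing-+ˡ m n x₂ x₁ x₄ x₃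
  meet-shift m n (true  , x₁) (false , x₂) (true  , x₃) (true  , x₄) = between-+ˡ n x₃ x₄ x₁
  meet-shift m n (true  , x₁) (true  , x₂) (false , x₃) (false , x₄) = refl
  meet-shift m n (true  , x₁) (true  , x₂) (false , x₃) (true  , x₄) = between-+ˡ n x₁ x₂ x₄
  meet-shift m n (true  , x₁) (true  , x₂) (true  , x₃) (false , x₄) = between-+ˡ n x₁ x₂ x₃
  meet-shift m n (true  , x₁) (true  , x₂) (true  , x₃) (true  , x₄) = overlap-+ˡ n x₁ x₂ x₃ x₄

  Marked⇒¬Shifted : ∀ m n u → Marked m n u → ¬ Shifted m n u
  Marked⇒¬Shifted m n (false , k) = ℕ.<⇒≱
  Marked⇒¬Shifted m n (true  , k) = ℕ.<⇒≱

  Marked-+ : ∀ {m n} p q u → Marked m n u → Marked (m + p) (n + q) u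
  Marked-+ {m} p q (false , k) h = ℕ.≤-trans h (ℕ.m≤m+n m p)
  Marked-+ {n = n} p q (true , k) h = ℕ.≤-trans h (ℕ.m≤m+n n q)

  restrict : ℕ → ℕ → (Point → Point) → Point → Point
  restrict m n φ = unshift m n ∘ φ ∘ shift m n

  restrict-admissible : ∀ m n {p q φ} → Admissible (m + p) (n + q) φ →
                        (∀ w → Marked p q w → Shifted m n (φ (shift m n w))) →
                        Admissible p q (restrict m n φ)
  restrict-admissible m n {p} {q} {φ} adm shifted = record
    { closed        = λ w hw → unshift-marked m n _ (shifted w hw) (closed adm _ (shift-marked m n w hw))
    ; involutive    = λ w hw → begin
        restrict m n φ (restrict m n φ w)          ≡⟨ cong (unshift m n ∘ φ) (back w hw) ⟩
        unshift m n (φ (φ (shift m n w)))          ≡⟨ cong (unshift m n) (involutive adm _ (shift-marked m n w hw)) ⟩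
        unshift m n (shift m n w)                  ≡⟨ unshift-shift m n w ⟩
        w                                          ∎
    ; fixpoint-free = λ w hw eq →
        fixpoint-free adm _ (shift-marked m n w hw) (trans (sym (back w hw)) (cong (shift m n) eq))
    ; disjoint      = λ w z hw hz z≢w z≢ψw → begin
        meet (w , ψ w) (z , ψ z)
          ≡⟨ meet-shift m n w (ψ w) z (ψ z) ⟨
        meet (shift m n w , shift m n (ψ w)) (shift m n z , shift m n (ψ z))
          ≡⟨ cong₂ (λ s t → meet (shift m n w , s) (shift m n z , t)) (back w hw) (back z hz) ⟩
        meet (shift m n w , φ (shift m n w)) (shift m n z , φ (shift m n z))
          ≡⟨ disjoint adm _ _ (shift-marked m n w hw) (shift-marked m n z hz)
                      (z≢w ∘ shift-injective m n) (λ eq → z≢ψw (shift-injective m n (trans eq (sym (back w hw))))) ⟩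
        false ∎
    }
    where
    ψ : Point → Point
    ψ = restrict m n φ
    back : ∀ w → Marked p q w → shift m n (ψ w) ≡ φ (shift m n w)
    back w hw = shift-unshift m n _ (shifted w hw)

  Agree : ℕ → ℕ → (Point → Point) → (Point → Point) → Set
  Agree p q φ ψ = ∀ u → Marked p q u → φ u ≡ ψ u

module Extensions where

  open import Data.Bool.Base using (false)
  import Data.Bool.Properties as Bool
  open import Data.Nat.Base using (_+_)
  import Data.Nat.Properties as ℕ
  open import Data.Product.Base using (_×_; _,_)
  open import Data.Product.Properties using (≡-dec)
  open import Data.Sum.Base using (_⊎_; inj₁; inj₂)
  open import Data.Empty using (⊥-elim)
  open import Data.List.Base using (map)
  open import Data.List.Relation.Unary.All using (All)
  import Data.List.Relation.Unary.All as All
  import Data.List.Relation.Unary.All.Properties as All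
  open import Function.Base using (_∘_)
  open import Function.Bundles using (_⇔_; mk⇔; Equivalence)
  open import Function.Properties.Equivalence using () renaming (trans to ⇔-trans)
  open import Relation.Nullary using (¬_; yes; no)
  open import Relation.Unary using (Decidable)
  open import Relation.Binary.Definitions using (DecidableEquality)
  open import Relation.Binary.PropositionalEquality
  open ≡-Reasoning
  open Counting
  open Matchings

  -- A decidable stand-in Q for agreement with φ: counting with an arbitrary such Q lets the recursion
  -- compose it with an extension, and the final count use equality of encodings.
  Characterises : ℕ → ℕ → (Point → Point) → ((Point → Point) → Set) → Set
  Characterises p q φ Q = ∀ g → Admissible p q g → Q g ⇔ Agree p q φ g

  count-disagreeing : ∀ {p q φ Q} (Q? : Decidable Q) → Characterises p q φ Q →
                      ∀ {u} → Marked p q u →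
                      ∀ {gs} → All (λ g → Admissible p q g × g u ≢ φ u) gs → count Q? gs ≡ 0
  count-disagreeing Q? χ {u} hu = count-none Q? ∘ All.map λ {g} (adm , gu≢φu) Qg →
    gu≢φu (sym (Equivalence.to (χ g adm) Qg u hu))

  _≟ₚ_ : DecidableEquality Point
  _≟ₚ_ = ≡-dec Bool._≟_ ℕ._≟_

  extend : ℕ → ℕ → Point → Point → (Point → Point) → Point → Point
  extend m n c d g u with u ≟ₚ c
  ... | yes _ = d
  ... | no _ with u ≟ₚ d
  ...   | yes _ = c
  ...   | no _  = shift m n (g (unshift m n u))

  record Apart (c d : Point) (s : Segment) : Set where
    constructor apart
    field
      cd-s : meet (c , d) s ≡ false
      dc-s : meet (d , c) s ≡ false
      s-cd : meet s (c , d) ≡ false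
      s-dc : meet s (d , c) ≡ false

  open Apart

  record Fresh (m n : ℕ) (c d : Point) : Set where
    field
      c-marked  : Marked m n c
      d-marked  : Marked m n d
      c≢d       : c ≢ d
      unshifted : ∀ u → ¬ Shifted m n u → u ≡ c ⊎ u ≡ d
      separated : ∀ w z → Apart c d (shift m n w , shift m n z)

  module _ {m n c d} (fresh : Fresh m n c d) where

    open Fresh fresh

    shift≢c : ∀ w → shift m n w ≢ c
    shift≢c w eq = Marked⇒¬Shifted m n c c-marked (subst (Shifted m n) eq (shift-Shifted m n w))

    shift≢d : ∀ w → shift m n w ≢ d
    shift≢d w eq = Marked⇒¬Shifted m n d d-marked (subst (Shifted m n) eq (shift-Shifted m n w))

    extend-c : ∀ g → extend m n c d g c ≡ d
    extend-c g with c ≟ₚ c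
    ... | yes _   = refl
    ... | no  c≢c = ⊥-elim (c≢c refl)

    extend-d : ∀ g → extend m n c d g d ≡ c
    extend-d g with d ≟ₚ c
    ... | yes d≡c = ⊥-elim (c≢d (sym d≡c))
    ... | no  _ with d ≟ₚ d
    ...   | yes _   = refl
    ...   | no  d≢d = ⊥-elim (d≢d refl)

    extend-shift : ∀ g w → extend m n c d g (shift m n w) ≡ shift m n (g w)
    extend-shift g w with shift m n w ≟ₚ c
    ... | yes eq = ⊥-elim (shift≢c w eq)
    ... | no  _ with shift m n w ≟ₚ d
    ...   | yes eq = ⊥-elim (shift≢d w eq)
    ...   | no  _  = cong (shift m n ∘ g) (unshift-shift m n w)

    data View (p q : ℕ) : Point → Set where
      at-c     : View p q c
      at-d     : View p q d
      at-shift : ∀ w → Marked p q w → View p q (shift m n w)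

    view : ∀ {p q} u → Marked (m + p) (n + q) u → View p q u
    view u hu with Shifted? m n u
    ... | yes sh = subst (View _ _) (shift-unshift m n u sh) (at-shift _ (unshift-marked m n u sh hu))
    ... | no ¬sh with unshifted u ¬sh
    ...   | inj₁ refl = at-c
    ...   | inj₂ refl = at-d

    extend-admissible : ∀ {p q g} → Admissible p q g → Admissible (m + p) (n + q) (extend m n c d g)
    extend-admissible {p} {q} {g} adm = record
      { closed = closed′ ; involutive = involutive′ ; fixpoint-free = fixpoint-free′ ; disjoint = disjoint′ }
      where
      ψ : Point → Point
      ψ = extend m n c d g

      closed′ : ∀ u → Marked (m + p) (n + q) u → Marked (m + p) (n + q) (ψ u)
      closed′ u hu with view u hu
      ... | at-c        = subst (Marked _ _) (sym (extend-c g)) (Marked-+ p q d d-marked)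
      ... | at-d        = subst (Marked _ _) (sym (extend-d g)) (Marked-+ p q c c-marked)
      ... | at-shift w hw = subst (Marked _ _) (sym (extend-shift g w)) (shift-marked m n (g w) (closed adm w hw))

      involutive′ : ∀ u → Marked (m + p) (n + q) u → ψ (ψ u) ≡ u
      involutive′ u hu with view u hu
      ... | at-c        = trans (cong ψ (extend-c g)) (extend-d g)
      ... | at-d        = trans (cong ψ (extend-d g)) (extend-c g)
      ... | at-shift w hw =
        trans (cong ψ (extend-shift g w)) (trans (extend-shift g (g w)) (cong (shift m n) (involutive adm w hw)))

      fixpoint-free′ : ∀ u → Marked (m + p) (n + q) u → ψ u ≢ u
      fixpoint-free′ u hu with view u hu
      ... | at-c        = λ eq → c≢d (trans (sym eq) (extend-c g))
      ... | at-d        = λ eq → c≢d (trans (sym (extend-d g)) eq)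
      ... | at-shift w hw = λ eq →
        fixpoint-free adm w hw (shift-injective m n (trans (sym (extend-shift g w)) eq))

      meet-via : ∀ u v {u′ v′} → ψ u ≡ u′ → ψ v ≡ v′ → meet (u , u′) (v , v′) ≡ false →
                 meet (u , ψ u) (v , ψ v) ≡ false
      meet-via u v e₁ e₂ = subst₂ (λ s t → meet (u , s) (v , t) ≡ false) (sym e₁) (sym e₂)

      disjoint′ : ∀ u v → Marked (m + p) (n + q) u → Marked (m + p) (n + q) v → v ≢ u → v ≢ ψ u →
                  meet (u , ψ u) (v , ψ v) ≡ false
      disjoint′ u v hu hv v≢u v≢ψu with view u hu | view v hv
      ... | at-c | at-c = ⊥-elim (v≢u refl)
      ... | at-c | at-d = ⊥-elim (v≢ψu (sym (extend-c g)))
      ... | at-d | at-c = ⊥-elim (v≢ψu (sym (extend-d g)))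
      ... | at-d | at-d = ⊥-elim (v≢u refl)
      ... | at-c | at-shift z _ = meet-via c (shift m n z) (extend-c g) (extend-shift g z) (cd-s (separated z (g z)))
      ... | at-d | at-shift z _ = meet-via d (shift m n z) (extend-d g) (extend-shift g z) (dc-s (separated z (g z)))
      ... | at-shift w _ | at-c = meet-via (shift m n w) c (extend-shift g w) (extend-c g) (s-cd (separated w (g w)))
      ... | at-shift w _ | at-d = meet-via (shift m n w) d (extend-shift g w) (extend-d g) (s-dc (separated w (g w)))
      ... | at-shift w hw | at-shift z hz =
        meet-via (shift m n w) (shift m n z) (extend-shift g w) (extend-shift g z)
          (trans (meet-shift m n w (g w) z (g z))
                 (disjoint adm w z hw hz (v≢u ∘ cong (shift m n))
                           (λ eq → v≢ψu (trans (cong (shift m n) eq) (sym (extend-shift g w))))))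

    module _ {p q φ} (adm : Admissible (m + p) (n + q) φ) (φc≡d : φ c ≡ d) where

      φd≡c : φ d ≡ c
      φd≡c = partner-partner adm (Marked-+ p q c c-marked) φc≡d

      partners-shifted : ∀ w → Marked p q w → Shifted m n (φ (shift m n w))
      partners-shifted w hw with Shifted? m n (φ (shift m n w))
      ... | yes sh = sh
      ... | no ¬sh with unshifted _ ¬sh
      ...   | inj₁ φw≡c = ⊥-elim (shift≢d w (trans (sym (partner-partner adm (shift-marked m n w hw) φw≡c)) φc≡d))
      ...   | inj₂ φw≡d = ⊥-elim (shift≢c w (trans (sym (partner-partner adm (shift-marked m n w hw) φw≡d)) φd≡c))

      restrict-fresh-admissible : Admissible p q (restrict m n φ)
      restrict-fresh-admissible = restrict-admissible m n adm partners-shifted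

      agree-extend : ∀ g → Agree (m + p) (n + q) φ (extend m n c d g) ⇔ Agree p q (restrict m n φ) g
      agree-extend g = mk⇔ to from
        where
        to : Agree (m + p) (n + q) φ (extend m n c d g) → Agree p q (restrict m n φ) g
        to agree w hw = begin
          unshift m n (φ (shift m n w))                     ≡⟨ cong (unshift m n) (agree _ (shift-marked m n w hw)) ⟩
          unshift m n (extend m n c d g (shift m n w))      ≡⟨ cong (unshift m n) (extend-shift g w) ⟩
          unshift m n (shift m n (g w))                     ≡⟨ unshift-shift m n (g w) ⟩
          g w                                               ∎
        from : Agree p q (restrict m n φ) g → Agree (m + p) (n + q) φ (extend m n c d g)
        from agree u hu with view u hu
        ... | at-c = trans φc≡d (sym (extend-c g))
        ... | at-d = trans φd≡c (sym (extend-d g))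
        ... | at-shift w hw = begin
          φ (shift m n w)                                   ≡⟨ shift-unshift m n _ (partners-shifted w hw) ⟨
          shift m n (restrict m n φ w)                      ≡⟨ cong (shift m n) (agree w hw) ⟩
          shift m n (g w)                                   ≡⟨ extend-shift g w ⟨
          extend m n c d g (shift m n w)                    ∎

      characterises-extend : ∀ {Q} → Characterises (m + p) (n + q) φ Q →
                             Characterises p q (restrict m n φ) (Q ∘ extend m n c d)
      characterises-extend χ g adm-g = ⇔-trans (χ (extend m n c d g) (extend-admissible adm-g)) (agree-extend g)

    extensions-disagree : ∀ {p q φ Q} (Q? : Decidable Q) → Characterises (m + p) (n + q) φ Q →
                          ∀ {u v} → Marked (m + p) (n + q) u → (∀ g → extend m n c d g u ≡ v) → φ u ≢ v →
                          ∀ {gs} → All (Admissible p q) gs → count Q? (map (extend m n c d) gs) ≡ 0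
    extensions-disagree Q? χ hu ext≡v φu≢v adms = count-disagreeing Q? χ hu
      (All.map⁺ (All.map (λ {g} adm → extend-admissible adm , λ e → φu≢v (trans (sym e) (ext≡v g))) adms))

module Enumeration where

  open import Data.Bool.Base using (true; false)
  open import Data.Nat.Base using (zero; suc; _+_; z≤n; s≤s)
  import Data.Nat.Properties as ℕ
  open import Data.Product.Base using (_,_; ∃)
  open import Data.Sum.Base using (_⊎_; inj₁; inj₂; [_,_]′)
  open import Data.Empty using (⊥; ⊥-elim)
  open import Data.List.Base using (List; []; _∷_; _++_; map)
  open import Data.List.Relation.Unary.All using (All; []; _∷_)
  import Data.List.Relation.Unary.All as All
  import Data.List.Relation.Unary.All.Properties as All
  open import Function.Base using (_∘_; id)
  open import Function.Bundles using (Equivalence)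
  open import Relation.Nullary.Decidable using (toSum)
  open import Relation.Unary using (Decidable)
  open import Relation.Binary.PropositionalEquality
  open ≡-Reasoning
  open Counting
  open Matchings
  open Extensions

  pattern f₀ = (false , zero)
  pattern f₁ = (false , suc zero)
  pattern s₀ = (true , zero)
  pattern s₁ = (true , suc zero)

  pairFirst-fresh : Fresh 2 0 f₀ f₁
  pairFirst-fresh = record
    { c-marked  = s≤s z≤n
    ; d-marked  = s≤s (s≤s z≤n)
    ; c≢d       = λ ()
    ; unshifted = λ { f₀ _ → inj₁ refl ; f₁ _ → inj₂ refl
                    ; (false , suc (suc k)) ¬sh → ⊥-elim (¬sh (s≤s (s≤s z≤n)))
                    ; (true , k) ¬sh → ⊥-elim (¬sh z≤n) }
    ; separated = λ { (false , _) (false , _) → apart refl refl refl refl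
                    ; (false , _) (true  , _) → apart refl refl refl refl
                    ; (true  , _) (false , _) → apart refl refl refl refl
                    ; (true  , _) (true  , _) → apart refl refl refl refl } }

  pairSecond-fresh : Fresh 0 2 s₀ s₁
  pairSecond-fresh = record
    { c-marked  = s≤s z≤n
    ; d-marked  = s≤s (s≤s z≤n)
    ; c≢d       = λ ()
    ; unshifted = λ { s₀ _ → inj₁ refl ; s₁ _ → inj₂ refl
                    ; (true , suc (suc k)) ¬sh → ⊥-elim (¬sh (s≤s (s≤s z≤n)))
                    ; (false , k) ¬sh → ⊥-elim (¬sh z≤n) }
    ; separated = λ { (false , _) (false , _) → apart refl refl refl refl
                    ; (false , _) (true  , _) → apart refl refl refl refl
                    ; (true  , _) (false , _) → apart refl refl refl refl
                    ; (true  , _) (true  , _) → apart refl refl refl refl } }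

  rung-fresh : Fresh 1 1 f₀ s₀
  rung-fresh = record
    { c-marked  = s≤s z≤n
    ; d-marked  = s≤s z≤n
    ; c≢d       = λ ()
    ; unshifted = λ { f₀ _ → inj₁ refl ; s₀ _ → inj₂ refl
                    ; (false , suc k) ¬sh → ⊥-elim (¬sh (s≤s z≤n))
                    ; (true , suc k) ¬sh → ⊥-elim (¬sh (s≤s z≤n)) }
    ; separated = λ { (false , _) (false , _) → apart refl refl refl refl
                    ; (false , _) (true  , _) → apart refl refl refl refl
                    ; (true  , _) (false , _) → apart refl refl refl refl
                    ; (true  , _) (true  , _) → apart refl refl refl refl } }

  pairFirst pairSecond rung : (Point → Point) → Point → Point
  pairFirst  = extend 2 0 f₀ f₁
  pairSecond = extend 0 2 s₀ s₁
  rung       = extend 1 1 f₀ s₀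

  matchings : ℕ → ℕ → List (Point → Point)
  -- those admissible matchings in which f₀ is not the partner of f₁
  matchings′ : ℕ → ℕ → List (Point → Point)

  matchings zero          q = matchings′ zero q
  matchings (suc zero)    q = matchings′ (suc zero) q
  matchings (suc (suc p)) q = matchings′ (suc (suc p)) q ++ map pairFirst (matchings p q)

  matchings′ zero    zero          = id ∷ []
  matchings′ zero    (suc zero)    = []
  matchings′ zero    (suc (suc q)) = map pairSecond (matchings′ zero q)
  matchings′ (suc p) zero          = []
  matchings′ (suc p) (suc zero)    = map rung (matchings p zero)
  matchings′ (suc p) (suc (suc q)) = map rung (matchings p (suc q)) ++ map pairSecond (matchings′ (suc p) q)

  id-admissible : Admissible 0 0 id
  id-admissible = record
    { closed        = λ { (false , _) () ; (true , _) () }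
    ; involutive    = λ { (false , _) () ; (true , _) () }
    ; fixpoint-free = λ { (false , _) () ; (true , _) () }
    ; disjoint      = λ { (false , _) _ () ; (true , _) _ () } }

  matchings-admissible  : ∀ p q → All (Admissible p q) (matchings p q)
  matchings′-admissible : ∀ p q → All (Admissible p q) (matchings′ p q)

  matchings-admissible zero          q = matchings′-admissible zero q
  matchings-admissible (suc zero)    q = matchings′-admissible (suc zero) q
  matchings-admissible (suc (suc p)) q = All.++⁺ (matchings′-admissible (suc (suc p)) q)
    (All.map⁺ (All.map (extend-admissible pairFirst-fresh) (matchings-admissible p q)))

  matchings′-admissible zero    zero          = id-admissible ∷ []
  matchings′-admissible zero    (suc zero)    = []
  matchings′-admissible zero    (suc (suc q)) =
    All.map⁺ (All.map (extend-admissible pairSecond-fresh) (matchings′-admissible zero q))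
  matchings′-admissible (suc p) zero          = []
  matchings′-admissible (suc p) (suc zero)    =
    All.map⁺ (All.map (extend-admissible rung-fresh) (matchings-admissible p zero))
  matchings′-admissible (suc p) (suc (suc q)) = All.++⁺
    (All.map⁺ (All.map (extend-admissible rung-fresh) (matchings-admissible p (suc q))))
    (All.map⁺ (All.map (extend-admissible pairSecond-fresh) (matchings′-admissible (suc p) q)))

  rung-f₀≢f₁ : ∀ g → rung g f₀ ≢ f₁
  rung-f₀≢f₁ g eq with trans (sym (extend-c rung-fresh g)) eq
  ... | ()

  pairSecond-f₀≢f₁ : ∀ g → g f₀ ≢ f₁ → pairSecond g f₀ ≢ f₁
  pairSecond-f₀≢f₁ g g₀≢f₁ eq =
    g₀≢f₁ (shift⁻¹-f₁ (g f₀) (trans (sym (extend-shift pairSecond-fresh g f₀)) eq))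
    where
    shift⁻¹-f₁ : ∀ u → shift 0 2 u ≡ f₁ → u ≡ f₁
    shift⁻¹-f₁ (false , _) eq = eq
    shift⁻¹-f₁ (true  , _) ()

  matchings′-f₀≢f₁ : ∀ p q → All (λ g → g f₀ ≢ f₁) (matchings′ p q)
  matchings′-f₀≢f₁ zero    zero          = (λ ()) ∷ []
  matchings′-f₀≢f₁ zero    (suc zero)    = []
  matchings′-f₀≢f₁ zero    (suc (suc q)) =
    All.map⁺ (All.map (λ {g} → pairSecond-f₀≢f₁ g) (matchings′-f₀≢f₁ zero q))
  matchings′-f₀≢f₁ (suc p) zero          = []
  matchings′-f₀≢f₁ (suc p) (suc zero)    = All.map⁺ (All.universal rung-f₀≢f₁ (matchings p zero))
  matchings′-f₀≢f₁ (suc p) (suc (suc q)) = All.++⁺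
    (All.map⁺ (All.universal rung-f₀≢f₁ (matchings p (suc q))))
    (All.map⁺ (All.map (λ {g} → pairSecond-f₀≢f₁ g) (matchings′-f₀≢f₁ (suc p) q)))

  true≢false : true ≢ false
  true≢false ()

  encloses : ∀ l k z → meet ((l , 0) , (l , suc (suc k))) ((l , 1) , z) ≡ true
  encloses false k (false , zero)  = refl
  encloses false k (false , suc _) = refl
  encloses false k (true  , _)     = refl
  encloses true  k (false , _)     = refl
  encloses true  k (true  , zero)  = refl
  encloses true  k (true  , suc _) = refl

  no-nesting : ∀ {p q φ} → Admissible p q φ → ∀ l k → Marked p q (l , 0) → φ (l , 0) ≢ (l , suc (suc k))
  no-nesting {p} {q} {φ} adm l k h₀ eq = true≢false (begin
    true                                              ≡⟨ encloses l k (φ (l , 1)) ⟨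
    meet ((l , 0) , (l , suc (suc k))) ((l , 1) , φ (l , 1))
                                                      ≡⟨ cong (λ t → meet ((l , 0) , t) ((l , 1) , φ (l , 1))) eq ⟨
    meet ((l , 0) , φ (l , 0)) ((l , 1) , φ (l , 1))  ≡⟨ disjoint adm _ _ h₀ h₁ (λ ()) (λ e → 1≢2+k (trans e eq)) ⟩
    false                                             ∎)
    where
    h₁ : Marked p q (l , 1)
    h₁ = Marked-≤ l (s≤s z≤n) (subst (Marked p q) eq (closed adm _ h₀))
    1≢2+k : (l , 1) ≢ (l , suc (suc k))
    1≢2+k ()

  first-partner : ∀ {p q φ} → Admissible p q φ → Marked p q f₀ → φ f₀ ≡ f₁ ⊎ ∃ λ j → φ f₀ ≡ (true , j)
  first-partner {φ = φ} adm h with φ f₀ in eq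
  ... | false , zero        = ⊥-elim (fixpoint-free adm f₀ h eq)
  ... | false , suc zero    = inj₁ refl
  ... | false , suc (suc k) = ⊥-elim (no-nesting adm false k h eq)
  ... | true  , j           = inj₂ (j , refl)

  -- Any other partner of s₀ would enclose s₁, or make the segment at s₀ cross the one at f₀.
  second-partner : ∀ {p q φ} → Admissible p q φ → Marked p q s₀ → (Marked p q f₀ → φ f₀ ≢ f₁) →
                   φ s₀ ≡ s₁ ⊎ φ s₀ ≡ f₀
  second-partner {p} {q} {φ} adm h first≢f₁ with φ s₀ in eq
  ... | true  , zero        = ⊥-elim (fixpoint-free adm s₀ h eq)
  ... | true  , suc zero    = inj₁ refl
  ... | true  , suc (suc k) = ⊥-elim (no-nesting adm true k h eq)
  ... | false , zero        = inj₂ refl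
  ... | false , suc i       = ⊥-elim (impossible (first-partner adm h-f₀))
    where
    h-f₀ : Marked p q f₀
    h-f₀ = Marked-≤ {p} {q} false z≤n (subst (Marked p q) eq (closed adm s₀ h))
    impossible : φ f₀ ≡ f₁ ⊎ ∃ (λ j → φ f₀ ≡ (true , j)) → ⊥
    impossible (inj₁ e)           = first≢f₁ h-f₀ e
    impossible (inj₂ (zero , e))  = 1+i≢0 (trans (sym eq) (partner-partner adm h-f₀ e))
      where
      1+i≢0 : (false , suc i) ≢ f₀
      1+i≢0 ()
    impossible (inj₂ (suc j , e)) = true≢false (subst₂ (λ x y → meet (f₀ , x) (s₀ , y) ≡ false) e eq
                                                       (disjoint adm f₀ s₀ h-f₀ h (λ ()) (λ e′ → s₀≢ (trans e′ e))))
      where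
      s₀≢ : s₀ ≢ (true , suc j)
      s₀≢ ()

  -- The helpers of the recursive clauses receive the results of the recursive calls as arguments:
  -- calling back from a where-block would hide the decrease of p and q from the termination checker.
  count-matchings≡1  : ∀ p q {φ} → Admissible p q φ →
                     ∀ {Q} (Q? : Decidable Q) → Characterises p q φ Q → count Q? (matchings p q) ≡ 1
  count-matchings′≡1 : ∀ p q {φ} → Admissible p q φ → (Marked p q f₀ → φ f₀ ≢ f₁) →
                     ∀ {Q} (Q? : Decidable Q) → Characterises p q φ Q → count Q? (matchings′ p q) ≡ 1

  count-matchings≡1 zero       q adm = count-matchings′≡1 zero q adm (λ ())
  count-matchings≡1 (suc zero) q adm = count-matchings′≡1 (suc zero) q adm
    (λ h e → ℕ.<-irrefl refl (partner-marked adm h e))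
  count-matchings≡1 (suc (suc p)) q {φ} adm Q? χ = [
      (λ e → first-paired e (count-matchings≡1 p q (restrict-fresh-admissible pairFirst-fresh adm e) (Q? ∘ pairFirst)
                                               (characterises-extend pairFirst-fresh adm e χ))) ,
      (λ ne → first-unpaired ne (count-matchings′≡1 (suc (suc p)) q adm (λ _ → ne) Q? χ)) ]′
    (toSum (φ f₀ ≟ₚ f₁))
    where
    first-paired : φ f₀ ≡ f₁ → count (Q? ∘ pairFirst) (matchings p q) ≡ 1 → count Q? (matchings (suc (suc p)) q) ≡ 1
    first-paired e ih = begin
      count Q? (matchings′ (suc (suc p)) q ++ map pairFirst (matchings p q))
        ≡⟨ count-++ Q? (matchings′ (suc (suc p)) q) _ ⟩
      count Q? (matchings′ (suc (suc p)) q) + count Q? (map pairFirst (matchings p q))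
        ≡⟨ cong₂ _+_ (count-disagreeing Q? χ (s≤s z≤n)
                        (All.zip (matchings′-admissible (suc (suc p)) q
                                 , All.map (λ g₀≢f₁ g₀≡φ₀ → g₀≢f₁ (trans g₀≡φ₀ e))
                                           (matchings′-f₀≢f₁ (suc (suc p)) q))))
                     (trans (count-map Q? pairFirst (matchings p q)) ih) ⟩
      0 + 1 ∎
    first-unpaired : φ f₀ ≢ f₁ → count Q? (matchings′ (suc (suc p)) q) ≡ 1 → count Q? (matchings (suc (suc p)) q) ≡ 1
    first-unpaired ne ih = trans (count-++ Q? (matchings′ (suc (suc p)) q) _)
      (cong₂ _+_ ih (extensions-disagree pairFirst-fresh Q? χ (s≤s z≤n) (extend-c pairFirst-fresh) ne
                                         (matchings-admissible p q)))

  count-matchings′≡1 zero zero adm first≢f₁ Q? χ =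
    count-single Q? (Equivalence.from (χ id id-admissible) λ { (false , _) () ; (true , _) () })
  count-matchings′≡1 zero (suc zero) adm first≢f₁ Q? χ = [
      (λ e → ⊥-elim (ℕ.<-irrefl refl (partner-marked adm (s≤s z≤n) e))) ,
      (λ e → ⊥-elim (ℕ.n≮0 (partner-marked adm (s≤s z≤n) e))) ]′
    (second-partner adm (s≤s z≤n) first≢f₁)
  count-matchings′≡1 zero (suc (suc q)) adm first≢f₁ Q? χ = [
      (λ e → trans (count-map Q? pairSecond (matchings′ zero q))
               (count-matchings′≡1 zero q (restrict-fresh-admissible pairSecond-fresh adm e) (λ ()) (Q? ∘ pairSecond)
                                 (characterises-extend pairSecond-fresh adm e χ))) ,
      (λ e → ⊥-elim (ℕ.n≮0 (partner-marked adm (s≤s z≤n) e))) ]′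
    (second-partner adm (s≤s z≤n) first≢f₁)
  count-matchings′≡1 (suc p) zero adm first≢f₁ Q? χ = [
      (λ e → ⊥-elim (first≢f₁ (s≤s z≤n) e)) ,
      (λ (_ , e) → ⊥-elim (ℕ.n≮0 (partner-marked adm (s≤s z≤n) e))) ]′
    (first-partner adm (s≤s z≤n))
  count-matchings′≡1 (suc p) (suc zero) adm first≢f₁ Q? χ = [
      (λ e → ⊥-elim (ℕ.<-irrefl refl (partner-marked adm (s≤s z≤n) e))) ,
      (λ e → let e′ = partner-partner adm (s≤s z≤n) e in
             trans (count-map Q? rung (matchings p zero))
               (count-matchings≡1 p zero (restrict-fresh-admissible rung-fresh adm e′) (Q? ∘ rung)
                                (characterises-extend rung-fresh adm e′ χ))) ]′
    (second-partner adm (s≤s z≤n) first≢f₁)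
  count-matchings′≡1 (suc p) (suc (suc q)) {φ} adm first≢f₁ Q? χ = [
      (λ e → second-paired e (count-matchings′≡1 (suc p) q (restrict-fresh-admissible pairSecond-fresh adm e) first′≢f₁
                                                (Q? ∘ pairSecond) (characterises-extend pairSecond-fresh adm e χ))) ,
      (λ e → let e′ = partner-partner adm (s≤s z≤n) e in
             second-rung e (count-matchings≡1 p (suc q) (restrict-fresh-admissible rung-fresh adm e′) (Q? ∘ rung)
                                            (characterises-extend rung-fresh adm e′ χ))) ]′
    (second-partner adm (s≤s z≤n) first≢f₁)
    where
    first′≢f₁ : Marked (suc p) q f₀ → restrict 0 2 φ f₀ ≢ f₁
    first′≢f₁ h e = first≢f₁ h (unshift⁻¹-f₁ (φ f₀) e)
      where
      unshift⁻¹-f₁ : ∀ u → unshift 0 2 u ≡ f₁ → u ≡ f₁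
      unshift⁻¹-f₁ (false , _) eq = eq
      unshift⁻¹-f₁ (true  , _) ()
    second-paired : φ s₀ ≡ s₁ → count (Q? ∘ pairSecond) (matchings′ (suc p) q) ≡ 1 →
                    count Q? (matchings′ (suc p) (suc (suc q))) ≡ 1
    second-paired e ih = trans (count-++ Q? (map rung (matchings p (suc q))) _)
      (cong₂ _+_ (extensions-disagree rung-fresh Q? χ (s≤s z≤n) (extend-d rung-fresh)
                                      (λ e′ → s₁≢f₀ (trans (sym e) e′))
                                      (matchings-admissible p (suc q)))
                 (trans (count-map Q? pairSecond (matchings′ (suc p) q)) ih))
      where
      s₁≢f₀ : s₁ ≢ f₀
      s₁≢f₀ ()
    second-rung : φ s₀ ≡ f₀ → count (Q? ∘ rung) (matchings p (suc q)) ≡ 1 →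
                  count Q? (matchings′ (suc p) (suc (suc q))) ≡ 1
    second-rung e ih = trans (count-++ Q? (map rung (matchings p (suc q))) _)
      (cong₂ _+_ (trans (count-map Q? rung (matchings p (suc q))) ih)
                 (extensions-disagree pairSecond-fresh Q? χ (s≤s z≤n) (extend-c pairSecond-fresh)
                                      (λ e′ → f₀≢s₁ (trans (sym e) e′)) (matchings′-admissible (suc p) q)))
      where
      f₀≢s₁ : f₀ ≢ s₁
      f₀≢s₁ ()

module Encoding (p q : ℕ) where

  open import Data.Bool.Base using (Bool; true; false; not; _∨_; if_then_else_; T)
  import Data.Bool.Properties as Bool
  open import Data.Nat.Base using (zero; suc; _+_; _∸_; _≤_; _<_; _<ᵇ_)
  import Data.Nat.Properties as ℕ
  open import Data.Fin.Base using (Fin; toℕ; fromℕ<)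
  import Data.Fin.Properties as Fin
  open import Data.Vec.Base using (Vec; []; _∷_; lookup; tabulate)
  open import Data.List.Base using (allFin)
  import Data.List.Relation.Unary.All.Properties as All
  import Data.Vec.Properties as Vec
  open import Data.Product.Base using (_×_; _,_; proj₁; proj₂)
  open import Data.Empty using (⊥-elim)
  open import Function.Base using (_∘_)
  open import Function.Bundles using (_⇔_; mk⇔; Equivalence)
  open import Relation.Nullary using (¬_; yes; no)
  open import Relation.Binary.PropositionalEquality
  open ≡-Reasoning
  open Matchings using (Marked; Admissible; Agree; closed; involutive; fixpoint-free; disjoint)

  N : ℕ
  N = p + q

  -- Defs.pt p q i unfolds to point (toℕ i).
  point : ℕ → Point
  point i = if i <ᵇ p then (false , i) else (true , i ∸ p)

  index : Point → ℕ
  index (false , k) = k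
  index (true  , k) = p + k

  index-point : ∀ i → index (point i) ≡ i
  index-point i with i <ᵇ p in eq
  ... | true  = refl
  ... | false = ℕ.m+[n∸m]≡n {p} {i} (ℕ.≮⇒≥ λ i<p → subst T eq (ℕ.<⇒<ᵇ i<p))

  point-index : ∀ u → Marked p q u → point (index u) ≡ u
  point-index (false , k) k<p rewrite Equivalence.to Bool.T-≡ (ℕ.<⇒<ᵇ k<p) = refl
  point-index (true  , k) _ with p + k <ᵇ p in eq
  ... | true  = ⊥-elim (ℕ.m+n≮m p k (ℕ.<ᵇ⇒< (p + k) p (Equivalence.from Bool.T-≡ eq)))
  ... | false = cong (true ,_) (ℕ.m+n∸m≡n p k)

  point-marked : ∀ i → i < N → Marked p q (point i)
  point-marked i i<N with i <ᵇ p in eq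
  ... | true  = ℕ.<ᵇ⇒< i p (Equivalence.from Bool.T-≡ eq)
  ... | false = ℕ.+-cancelˡ-< p (i ∸ p) q (subst (_< N) (sym (ℕ.m+[n∸m]≡n {p} {i} p≤i)) i<N)
    where
    p≤i : p ≤ i
    p≤i = ℕ.≮⇒≥ {i} {p} λ i<p → subst T eq (ℕ.<⇒<ᵇ i<p)

  index-marked : ∀ u → Marked p q u → index u < N
  index-marked (false , k) k<p = ℕ.≤-trans k<p (ℕ.m≤m+n p q)
  index-marked (true  , k) k<q = ℕ.+-monoʳ-< p k<q

  pt-marked : ∀ i → Marked p q (pt p q i)
  pt-marked i = point-marked (toℕ i) (Fin.toℕ<n i)

  pt-injective : ∀ {i j} → pt p q i ≡ pt p q j → i ≡ j
  pt-injective {i} {j} e = Fin.toℕ-injective (begin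
    toℕ i                ≡⟨ index-point (toℕ i) ⟨
    index (pt p q i)     ≡⟨ cong index e ⟩
    index (pt p q j)     ≡⟨ index-point (toℕ j) ⟩
    toℕ j                ∎)

  ∀-marked : ∀ {P : Point → Set} → (∀ i → P (pt p q i)) → ∀ u → Marked p q u → P u
  ∀-marked {P} P-pt u hu = subst P pt-i≡u (P-pt i)
    where
    i : Fin N
    i = fromℕ< (index-marked u hu)
    pt-i≡u : pt p q i ≡ u
    pt-i≡u = trans (cong point (Fin.toℕ-fromℕ< (index-marked u hu))) (point-index u hu)

  T-finEq : ∀ {n} {i j : Fin n} → T (finEq i j) ⇔ i ≡ j
  T-finEq {i = i} {j} =
    mk⇔ (Fin.toℕ-injective ∘ ℕ.≡ᵇ⇒≡ (toℕ i) (toℕ j)) (ℕ.≡⇒≡ᵇ (toℕ i) (toℕ j) ∘ cong toℕ)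

  finEq-≢ : ∀ {n} {i j : Fin n} → i ≢ j → finEq i j ≡ false
  finEq-≢ {i = i} {j} i≢j with finEq i j in eq
  ... | true  = ⊥-elim (i≢j (Equivalence.to T-finEq (subst T (sym eq) _)))
  ... | false = refl

  T-allᵇ : ∀ n (P : Fin n → Bool) → T (allᵇ n P) ⇔ (∀ i → T (P i))
  T-allᵇ n P = mk⇔ (All.tabulate⁻ ∘ All.all⁺ P (allFin n)) (All.all⁻ P ∘ All.tabulate⁺)

  Realises : (Point → Point) → Vec (Fin N) N → Set
  Realises φ x = ∀ i → φ (pt p q i) ≡ pt p q (lookup x i)

  module _ {φ x} (φ-realises : Realises φ x) where

    private
      f : Fin N → Fin N
      f = lookup x

      not-T : ∀ {b} → T (not b) → ¬ T b
      not-T {true} ()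

      T-not : ∀ {b} → b ≡ false → T (not b)
      T-not refl = _

      meet-pt : ∀ i j → meet (pt p q i , φ (pt p q i)) (pt p q j , φ (pt p q j))
                      ≡ meet (pt p q i , pt p q (f i)) (pt p q j , pt p q (f j))
      meet-pt i j = cong₂ (λ s t → meet (pt p q i , s) (pt p q j , t)) (φ-realises i) (φ-realises j)

    valid⇒admissible : T (validMatching p q x) → Admissible p q φ
    valid⇒admissible valid = record
      { closed        = ∀-marked λ i → subst (Marked p q) (sym (φ-realises i)) (pt-marked (f i))
      ; involutive    = ∀-marked λ i → begin
          φ (φ (pt p q i))       ≡⟨ cong φ (φ-realises i) ⟩
          φ (pt p q (f i))       ≡⟨ φ-realises (f i) ⟩
          pt p q (f (f i))       ≡⟨ cong (pt p q) (Equivalence.to T-finEq (proj₂ (partner i))) ⟩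
          pt p q i               ∎
      ; fixpoint-free = ∀-marked λ i e →
          not-T (proj₁ (partner i)) (Equivalence.from T-finEq (pt-injective (trans (sym (φ-realises i)) e)))
      ; disjoint      = λ u v hu hv →
          ∀-marked {λ u → v ≢ u → v ≢ φ u → meet (u , φ u) (v , φ v) ≡ false}
                   (λ i → ∀-marked {λ v → v ≢ pt p q i → v ≢ φ (pt p q i) → _} (disjoint-pt i) v hv) u hu
      }
      where
      partner : ∀ i → T (not (finEq (f i) i)) × T (finEq (f (f i)) i)
      partner i = Equivalence.to Bool.T-∧ (Equivalence.to (T-allᵇ N _) (proj₁ (Equivalence.to Bool.T-∧ valid)) i)
      clause : ∀ i j → T (if finEq j i ∨ finEq j (f i) then true
                          else not (meet (pt p q i , pt p q (f i)) (pt p q j , pt p q (f j))))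
      clause i j = Equivalence.to (T-allᵇ N _) (Equivalence.to (T-allᵇ N _) (proj₂ (Equivalence.to Bool.T-∧ valid)) i) j
      separate : ∀ i j → j ≢ i → j ≢ f i → meet (pt p q i , pt p q (f i)) (pt p q j , pt p q (f j)) ≡ false
      separate i j j≢i j≢fi with clause i j
      ... | c rewrite finEq-≢ j≢i | finEq-≢ j≢fi = Equivalence.to Bool.T-not-≡ c
      disjoint-pt : ∀ i j → pt p q j ≢ pt p q i → pt p q j ≢ φ (pt p q i) →
                    meet (pt p q i , φ (pt p q i)) (pt p q j , φ (pt p q j)) ≡ false
      disjoint-pt i j v≢u v≢φu = trans (meet-pt i j)
        (separate i j (v≢u ∘ cong (pt p q)) (λ e → v≢φu (trans (cong (pt p q) e) (sym (φ-realises i)))))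

    admissible⇒valid : Admissible p q φ → T (validMatching p q x)
    admissible⇒valid adm = Equivalence.from Bool.T-∧
      ( Equivalence.from (T-allᵇ N _) (λ i → Equivalence.from Bool.T-∧ (fixpoint-free′ i , involutive′ i))
      , Equivalence.from (T-allᵇ N _) (λ i → Equivalence.from (T-allᵇ N _) (disjoint′ i)) )
      where
      fixpoint-free′ : ∀ i → T (not (finEq (f i) i))
      fixpoint-free′ i = T-not (finEq-≢ λ fi≡i →
        fixpoint-free adm (pt p q i) (pt-marked i) (trans (φ-realises i) (cong (pt p q) fi≡i)))
      involutive′ : ∀ i → T (finEq (f (f i)) i)
      involutive′ i = Equivalence.from T-finEq (pt-injective (begin
        pt p q (f (f i))     ≡⟨ φ-realises (f i) ⟨
        φ (pt p q (f i))     ≡⟨ cong φ (φ-realises i) ⟨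
        φ (φ (pt p q i))     ≡⟨ involutive adm (pt p q i) (pt-marked i) ⟩
        pt p q i             ∎))
      disjoint′ : ∀ i j → T (if finEq j i ∨ finEq j (f i) then true
                             else not (meet (pt p q i , pt p q (f i)) (pt p q j , pt p q (f j))))
      disjoint′ i j with finEq j i in j≡i | finEq j (f i) in j≡fi
      ... | true  | _     = _
      ... | false | true  = _
      ... | false | false = T-not (trans (sym (meet-pt i j))
        (disjoint adm (pt p q i) (pt p q j) (pt-marked i) (pt-marked j)
                  (λ e → different j≡i (pt-injective e))
                  (λ e → different j≡fi (pt-injective (trans e (φ-realises i))))))
        where
        different : ∀ {k l : Fin N} → finEq k l ≡ false → k ≢ l
        different {k} eq refl = subst T eq (Equivalence.from (T-finEq {i = k}) refl)

  lookupℕ : ∀ {n m} → Vec (Fin m) n → ℕ → ℕ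
  lookupℕ []       _       = 0
  lookupℕ (y ∷ _)  zero    = toℕ y
  lookupℕ (_ ∷ ys) (suc k) = lookupℕ ys k

  lookupℕ-lookup : ∀ {n m} (x : Vec (Fin m) n) i → lookupℕ x (toℕ i) ≡ toℕ (lookup x i)
  lookupℕ-lookup (_ ∷ _)  Fin.zero    = refl
  lookupℕ-lookup (_ ∷ ys) (Fin.suc i) = lookupℕ-lookup ys i

  decode : Vec (Fin N) N → Point → Point
  decode x = point ∘ lookupℕ x ∘ index

  decode-realises : ∀ x → Realises (decode x) x
  decode-realises x i = cong point (trans (cong (lookupℕ x) (index-point (toℕ i))) (lookupℕ-lookup x i))

  clamp : ∀ {n} → Fin n → ℕ → Fin n
  clamp {n} i j with j ℕ.<? n
  ... | yes j<n = fromℕ< j<n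
  ... | no  _   = i

  toℕ-clamp : ∀ {n} (i : Fin n) {j} → j < n → toℕ (clamp i j) ≡ j
  toℕ-clamp {n} i {j} j<n with j ℕ.<? n
  ... | yes j<n′ = Fin.toℕ-fromℕ< j<n′
  ... | no  j≮n  = ⊥-elim (j≮n j<n)

  encode : (Point → Point) → Vec (Fin N) N
  encode g = tabulate λ i → clamp i (index (g (pt p q i)))

  encode-realises : ∀ {g} → Admissible p q g → Realises g (encode g)
  encode-realises {g} adm i = begin
    g (pt p q i)                                ≡⟨ point-index _ g-marked ⟨
    point (index (g (pt p q i)))                ≡⟨ cong point (toℕ-clamp i (index-marked _ g-marked)) ⟨
    point (toℕ (clamp i (index (g (pt p q i))))) ≡⟨ cong (pt p q) (Vec.lookup∘tabulate _ i) ⟨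
    pt p q (lookup (encode g) i)                ∎
    where
    g-marked : Marked p q (g (pt p q i))
    g-marked = closed adm _ (pt-marked i)

  ≡-encode⇔agree : ∀ {g} → Admissible p q g → ∀ x → (x ≡ encode g) ⇔ Agree p q (decode x) g
  ≡-encode⇔agree {g} adm x = mk⇔ to from
    where
    to : x ≡ encode g → Agree p q (decode x) g
    to refl = ∀-marked λ i → trans (decode-realises x i) (sym (encode-realises adm i))
    from : Agree p q (decode x) g → x ≡ encode g
    from agree = begin
      x                       ≡⟨ Vec.tabulate∘lookup x ⟨
      tabulate (lookup x)     ≡⟨ Vec.tabulate-cong lookup-agree ⟩
      tabulate (lookup (encode g)) ≡⟨ Vec.tabulate∘lookup (encode g) ⟩
      encode g                ∎
      where
      lookup-agree : ∀ i → lookup x i ≡ lookup (encode g) i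
      lookup-agree i = pt-injective (begin
        pt p q (lookup x i)            ≡⟨ decode-realises x i ⟨
        decode x (pt p q i)            ≡⟨ agree (pt p q i) (pt-marked i) ⟩
        g (pt p q i)                   ≡⟨ encode-realises adm i ⟩
        pt p q (lookup (encode g) i)   ∎)

module VectorEnumeration where

  open import Data.Bool.Base using (true; false; _∧_)
  import Data.Bool.Properties as Bool
  open import Data.Nat.Base using (zero; suc)
  open import Data.Nat.ListAction using (sum)
  open import Data.Fin.Base using (Fin)
  import Data.Fin.Properties as Fin
  open import Data.Vec.Base using (Vec; []; _∷_)
  import Data.Vec.Properties as Vec
  open import Data.List.Base using (List; map; concatMap; tabulate; allFin)
  open import Data.List.Properties using (map-cong; map-tabulate)
  open import Function.Base using (id)
  open import Relation.Nullary using (yes; no; does)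
  open import Relation.Binary.Definitions using (DecidableEquality)
  open import Relation.Binary.PropositionalEquality
  open ≡-Reasoning
  open Counting

  _≟ᵥ_ : ∀ {n m} → DecidableEquality (Vec (Fin m) n)
  _≟ᵥ_ = Vec.≡-dec Fin._≟_

  count-allFin : ∀ m (i : Fin m) → count (Fin._≟ i) (allFin m) ≡ 1
  count-allFin m i = trans (cong sum (map-tabulate id (λ j → indicator (does (j Fin.≟ i))))) (sum-indicators m i)
    where
    sum-zeros : ∀ m → sum (tabulate {n = m} (λ _ → 0)) ≡ 0
    sum-zeros zero    = refl
    sum-zeros (suc m) = sum-zeros m
    sum-indicators : ∀ m (i : Fin m) → sum (tabulate (λ j → indicator (does (j Fin.≟ i)))) ≡ 1
    sum-indicators (suc m) Fin.zero    = cong suc (sum-zeros m)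
    sum-indicators (suc m) (Fin.suc i) = sum-indicators m i

  does-∷ : ∀ {n m} (y y′ : Fin m) (w w′ : Vec (Fin m) n) →
           does ((y ∷ w) ≟ᵥ (y′ ∷ w′)) ≡ does (y Fin.≟ y′) ∧ does (w ≟ᵥ w′)
  does-∷ y y′ w w′ with y Fin.≟ y′ | w ≟ᵥ w′
  ... | yes refl | yes refl = refl
  ... | yes refl | no _     = refl
  ... | no _     | yes refl = refl
  ... | no _     | no _     = refl

  count-allVecs : ∀ n m (v : Vec (Fin m) n) → count (_≟ᵥ v) (allVecs n m) ≡ 1
  count-allVecs zero    m []       = refl
  count-allVecs (suc n) m (y ∷ v) = begin
    count (_≟ᵥ (y ∷ v)) (concatMap row (allVecs n m))
      ≡⟨ count-concatMap (_≟ᵥ (y ∷ v)) row (allVecs n m) ⟩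
    sum (map (λ w → count (_≟ᵥ (y ∷ v)) (row w)) (allVecs n m))
      ≡⟨ cong sum (map-cong count-row (allVecs n m)) ⟩
    count (_≟ᵥ v) (allVecs n m)
      ≡⟨ count-allVecs n m v ⟩
    1 ∎
    where
    row : Vec (Fin m) n → List (Vec (Fin m) (suc n))
    row w = map (_∷ w) (allFin m)
    count-row : ∀ w → count (_≟ᵥ (y ∷ v)) (row w) ≡ indicator (does (w ≟ᵥ v))
    count-row w = begin
      count (_≟ᵥ (y ∷ v)) (map (_∷ w) (allFin m))
        ≡⟨ count-map (_≟ᵥ (y ∷ v)) (_∷ w) (allFin m) ⟩
      sum (map (λ x → indicator (does ((x ∷ w) ≟ᵥ (y ∷ v)))) (allFin m))
        ≡⟨ cong sum (map-cong (λ x → cong indicator (does-∷ x y w v)) (allFin m)) ⟩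
      sum (map (λ x → indicator (does (x Fin.≟ y) ∧ does (w ≟ᵥ v))) (allFin m))
        ≡⟨ by-row (does (w ≟ᵥ v)) ⟩
      indicator (does (w ≟ᵥ v)) ∎
      where
      by-row : ∀ b → sum (map (λ x → indicator (does (x Fin.≟ y) ∧ b)) (allFin m)) ≡ indicator b
      by-row true  = trans (cong sum (map-cong (λ x → cong indicator (Bool.∧-identityʳ _)) (allFin m))) (count-allFin m y)
      by-row false = trans (cong sum (map-cong (λ x → cong indicator (Bool.∧-zeroʳ _)) (allFin m))) (sum-map-zero (allFin m))

module MatchingCount where

  open import Data.Bool.Base using (true; false; T)
  open import Data.Nat.Base using (zero; suc; _+_)
  import Data.Nat.Properties as ℕ
  open import Data.Nat.Solver using (module +-*-Solver)
  open import Data.Nat.ListAction using (sum)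
  open import Data.List.Base using (map; length)
  open import Data.List.Properties using (map-cong; length-++; length-map)
  import Data.List.Relation.Unary.All as All
  open import Relation.Nullary using (does)
  open import Relation.Binary.PropositionalEquality
  open ≡-Reasoning
  open Counting
  open VectorEnumeration
  open Enumeration using (matchings; matchings′; matchings-admissible; count-matchings≡1; pairFirst; pairSecond; rung)
  open PaddedRecurrence using (Recurrence)

  module _ (p q : ℕ) where

    open Encoding p q

    indicator-valid : ∀ x → indicator (validMatching p q x) ≡ count (λ g → x ≟ᵥ encode g) (matchings p q)
    indicator-valid x with validMatching p q x in valid
    ... | true  = sym (count-matchings≡1 p q (valid⇒admissible {x = x} (decode-realises x) (subst T (sym valid) _))
                                       (λ g → x ≟ᵥ encode g) (λ g adm → ≡-encode⇔agree adm x))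
    ... | false = sym (count-none (λ g → x ≟ᵥ encode g) (All.map x≢encode (matchings-admissible p q)))
      where
      x≢encode : ∀ {g} → Matchings.Admissible p q g → x ≢ encode g
      x≢encode {g} adm refl = subst T valid (admissible⇒valid {x = encode g} (encode-realises adm) adm)

    -- Double counting: a valid vector encodes exactly one listed matching, and the encoding of a
    -- listed matching occurs exactly once among all vectors.
    a≡length : a p q ≡ length (matchings p q)
    a≡length = begin
      sum (map (λ x → indicator (validMatching p q x)) (allVecs N N))
        ≡⟨ cong sum (map-cong indicator-valid (allVecs N N)) ⟩
      sum (map (λ x → count (λ g → x ≟ᵥ encode g) (matchings p q)) (allVecs N N))
        ≡⟨ sum-map-swap (λ x g → indicator (does (x ≟ᵥ encode g))) (allVecs N N) (matchings p q) ⟩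
      sum (map (λ g → count (_≟ᵥ encode g) (allVecs N N)) (matchings p q))
        ≡⟨ cong sum (map-cong (λ g → count-allVecs N N (encode g)) (matchings p q)) ⟩
      sum (map (λ _ → 1) (matchings p q))
        ≡⟨ sum-map-1 (matchings p q) ⟩
      length (matchings p q) ∎

  size size′ : ℕ → ℕ → ℕ
  size  p q = length (matchings p q)
  size′ p q = length (matchings′ p q)

  size-split : ∀ p q → size (suc (suc p)) q ≡ size′ (suc (suc p)) q + size p q
  size-split p q = trans (length-++ (matchings′ (suc (suc p)) q))
                         (cong (size′ (suc (suc p)) q +_) (length-map pairFirst (matchings p q)))

  size′-split : ∀ p q → size′ (suc p) (suc (suc q)) ≡ size p (suc q) + size′ (suc p) q
  size′-split p q = trans (length-++ (map rung (matchings p (suc q))))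
                          (cong₂ _+_ (length-map rung (matchings p (suc q))) (length-map pairSecond (matchings′ (suc p) q)))

  size-recurrence : Recurrence size
  size-recurrence zero          zero          = refl
  size-recurrence zero          (suc zero)    = refl
  size-recurrence zero          (suc (suc q)) = cong (_+ 0) (length-map pairSecond (matchings′ zero q))
  size-recurrence (suc zero)    zero          = refl
  size-recurrence (suc zero)    (suc zero)    = refl
  size-recurrence (suc zero)    (suc (suc q)) = cong (_+ 0) (size′-split zero q)
  size-recurrence (suc (suc p)) zero          = trans (ℕ.+-identityʳ _) (size-split p zero)
  size-recurrence (suc (suc p)) (suc zero)    = begin
    size (suc (suc p)) 1 + 0             ≡⟨ ℕ.+-identityʳ _ ⟩
    size (suc (suc p)) 1                 ≡⟨ size-split p 1 ⟩
    size′ (suc (suc p)) 1 + size p 1     ≡⟨ cong (_+ size p 1) (length-map rung (matchings (suc p) zero)) ⟩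
    size (suc p) 0 + size p 1            ≡⟨ cong (_+ size p 1) (ℕ.+-identityʳ _) ⟨
    size (suc p) 0 + 0 + size p 1        ∎
  size-recurrence (suc (suc p)) (suc (suc q))
    rewrite size-split p (suc (suc q)) | size′-split (suc p) q | size-split p q =
    +-*-Solver.solve 4 (λ w x y z → w :+ x :+ y :+ z := w :+ (x :+ z) :+ y) refl
                     (size (suc p) (suc q)) (size′ (suc (suc p)) q) (size p (suc (suc q))) (size p q)
    where open +-*-Solver using (_:+_; _:=_)

mainTheorem18 : IsInvSqrt diagSeries P
mainTheorem18 = IsInvSqrt-cong {h = P} (λ n → cong +_ (a≡length n n)) (Recurrence⇒IsInvSqrt size-recurrence)
  where
  open import Data.Integer.Base using (+_)
  open import Relation.Binary.PropositionalEquality using (cong)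
  open PowerSeries using (IsInvSqrt-cong)
  open DiagonalSeries using (Recurrence⇒IsInvSqrt)
  open MatchingCount using (a≡length; size-recurrence)
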